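{- Let $G$ be a graph and let $\Delta\ge DS_{f_{\mathrm{sf}}}(G)+1$. Then $f_\Delta(G)=f_{\mathrm{sf}}(G)$. Consequently, for all $\Delta\ge1$, $S^*_{\Delta-1}\subseteq S_\Delta$, where $S_\Delta=\{G : f_\Delta(G)=f_{\mathrm{sf}}(G)\}$ and $S^*_{\Delta}=\{G : DS_{f_{\mathrm{sf}}}(G)\le\Delta\}$.
   Context: Graphs are finite, undirected and unweighted. $f_{\mathrm{sf}}(G)$ is the number of edges of a spanning forest of $G$. Two graphs are node-neighbors if one is obtained from the other by deleting one vertex and its incident edges; $H\preceq H'$ means $H$ is an induced subgraph of $H'$; $DS_f(G)=\max\{|f(H')-f(H)| : H\preceq H'\preceq G,\ H,H' \text{ node-neighbors}\}$. For $G=(V,E)$ and $\Delta>0$, the $\Delta$-bounded forest polytope $\mathcal{P}_\Delta(G)$ is the set of $x\in\mathbb{R}^E$ with $x(e)\ge0$ for all $e\in E$; $x(E[S])\le|S|-1$ for all $S\subseteq V$ with $|S|\ge2$ (where $E[S]$ is the edge set of the subgraph induced by $S$); and $x(\delta(v))\le\Delta$ for all $v\in V$ (where $\delta(v)$ is the set of edges incident to $v$), with $x(F)=\sum_{e\in F}x(e)$. Define $f_\Delta(G)=\max_{x\in\mathcal{P}_\Delta(G)}x(E)$.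
   Formalization: The parameter Δ is rational and the points of the polytope $\mathcal{P}_\Delta(G)$ are taken in ℚ^E rather than $\mathbb{R}^E$. -}

module Defs where

open import Data.Nat as ℕ using (ℕ; zero; suc; ∣_-_∣)
open import Data.Integer using (+_)
open import Data.Rational as ℚ using (ℚ; 0ℚ; 1ℚ; _/_)
open import Data.Fin using (Fin; toℕ; _≟_)
open import Data.List using (List; foldr; allFin)
open import Data.Bool using (Bool; true; false; _∧_; not; if_then_else_)
open import Data.Product using (Σ; ∃; _×_; _,_)
open import Data.Sum using (_⊎_)
open import Relation.Binary.PropositionalEquality using (_≡_)
open import Relation.Nullary using (¬_)
open import Relation.Nullary.Decidable using (⌊_⌋)

record Graph (n : ℕ) : Set where
  field
    adj     : Fin n → Fin n → Bool
    adj-sym : ∀ u v → adj u v ≡ adj v u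
    adj-irr : ∀ v → adj v v ≡ false
open Graph public

-- An edge relation on Fin n: the (undirected) edge {i,j} with i < j
-- is present iff R i j ≡ true.  Only pairs with toℕ i < toℕ j matter.
EdgeRel : ℕ → Set
EdgeRel n = Fin n → Fin n → Bool

_<ᵇ_ : ∀ {n} → Fin n → Fin n → Bool
i <ᵇ j = toℕ i ℕ.<ᵇ toℕ j

IsEdge : ∀ {n} → EdgeRel n → Fin n → Fin n → Set
IsEdge R i j = (i <ᵇ j) ∧ R i j ≡ true

Adj : ∀ {n} → EdgeRel n → Fin n → Fin n → Set
Adj R u v = IsEdge R u v ⊎ IsEdge R v u

data Walk {n} (R : EdgeRel n) : Fin n → Fin n → Set where
  here : ∀ {u} → Walk R u u
  step : ∀ {u v w} → Adj R u v → Walk R v w → Walk R u w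

removeEdge : ∀ {n} → EdgeRel n → Fin n → Fin n → EdgeRel n
removeEdge R a b i j = R i j ∧ not (⌊ i ≟ a ⌋ ∧ ⌊ j ≟ b ⌋)

sumList : ∀ {A : Set} → List A → (A → ℚ) → ℚ
sumList xs f = foldr (λ a s → f a ℚ.+ s) 0ℚ xs

countList : ∀ {A : Set} → List A → (A → Bool) → ℕ
countList xs p = foldr (λ a s → if p a then suc s else s) 0 xs

sumEdges : ∀ {n} → EdgeRel n → (Fin n → Fin n → Bool) → (Fin n → Fin n → ℚ) → ℚ
sumEdges {n} R P x =
  sumList (allFin n) λ i → sumList (allFin n) λ j →
    if (i <ᵇ j) ∧ R i j ∧ P i j then x i j else 0ℚ

numEdges : ∀ {n} → EdgeRel n → ℕ
numEdges {n} R =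
  foldr ℕ._+_ 0 (Data.List.map (λ i → countList (allFin n) (λ j → (i <ᵇ j) ∧ R i j)) (allFin n))
  where import Data.List

Subset : ℕ → Set
Subset n = Fin n → Bool

card : ∀ {n} → Subset n → ℕ
card {n} S = countList (allFin n) S

-- edge relation of the induced subgraph G[S]
-- (vertices outside S are kept as isolated vertices, which does not
-- change the number of edges of a spanning forest)
induced : ∀ {n} → Graph n → Subset n → EdgeRel n
induced G S i j = S i ∧ S j ∧ adj G i j

delete : ∀ {n} → Subset n → Fin n → Subset n
delete S v i = S i ∧ not ⌊ i ≟ v ⌋

-- F is a forest contained in R: F ⊆ E(R), and no edge of F lies on a
-- cycle of F (its endpoints are disconnected once it is removed)
IsForestIn : ∀ {n} → EdgeRel n → EdgeRel n → Set
IsForestIn R F =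
  (∀ i j → IsEdge F i j → IsEdge R i j) ×
  (∀ i j → IsEdge F i j → ¬ Walk (removeEdge F i j) i j)

Spans : ∀ {n} → EdgeRel n → EdgeRel n → Set
Spans R F = ∀ i j → IsEdge R i j → Walk F i j

-- "f_sf = k": R has a spanning forest with exactly k edges
SFSize : ∀ {n} → EdgeRel n → ℕ → Set
SFSize R k = Σ _ λ F → IsForestIn R F × Spans R F × numEdges F ≡ k

-- d = |f_sf(H') - f_sf(H)| for a node-neighbour pair H ⪯ H' ⪯ G,
-- H' = G[S], H = G[S ∖ {v}], v ∈ S
NodeNeighbourDiff : ∀ {n} → Graph n → ℕ → Set
NodeNeighbourDiff {n} G d =
  Σ (Subset n) λ S → Σ (Fin n) λ v → S v ≡ true ×
    Σ ℕ λ k₁ → Σ ℕ λ k₂ →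
      SFSize (induced G S) k₁ × SFSize (induced G (delete S v)) k₂ × d ≡ ∣ k₁ - k₂ ∣

-- "DS_{f_sf}(G) = d": d is the maximum of these differences
-- (0 if there are no such pairs, i.e. for the empty graph)
IsDS : ∀ {n} → Graph n → ℕ → Set
IsDS G d = (∀ d′ → NodeNeighbourDiff G d′ → d′ ℕ.≤ d) × (d ≡ 0 ⊎ NodeNeighbourDiff G d)

ℕtoℚ : ℕ → ℚ
ℕtoℚ k = + k / 1

allPairs : ∀ {n} → Fin n → Fin n → Bool
allPairs _ _ = true

InPolytope : ∀ {n} → Graph n → ℚ → (Fin n → Fin n → ℚ) → Set
InPolytope {n} G Δ x =
  (∀ i j → IsEdge (adj G) i j → 0ℚ ℚ.≤ x i j) ×
  (∀ (S : Subset n) → 2 ℕ.≤ card S →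
      sumEdges (adj G) (λ i j → S i ∧ S j) x ℚ.≤ ℕtoℚ (card S) ℚ.- 1ℚ) ×
  (∀ v → sumEdges (adj G) (λ i j → ⌊ i ≟ v ⌋ Data.Bool.∨ ⌊ j ≟ v ⌋) x ℚ.≤ Δ)
  where import Data.Bool

-- "f_Δ(G) = val": val is the maximum of x(E) over P_Δ(G)
IsFDelta : ∀ {n} → Graph n → ℚ → ℚ → Set
IsFDelta G Δ val =
  (∀ x → InPolytope G Δ x → sumEdges (adj G) allPairs x ℚ.≤ val) ×
  (∃ λ x → InPolytope G Δ x × sumEdges (adj G) allPairs x ≡ val)

-- Cutting along the components of a spanning forest F₀ separates no edge of G, so for x in
-- P_Δ(G) the sum x(E) splits into sums over connected pieces S, each at most |S| - 1, which is
-- the number of edges of F₀ in S; hence f_Δ(G) ≤ |F₀| = f_sf(G). Conversely, the indicator of a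
-- spanning forest F of maximum degree at most DS + 1 ≤ Δ lies in P_Δ(G), and the same bound
-- applied to the indicator of F₀ gives |F₀| ≤ |F|. Such an F is built recursively: delete a
-- vertex r, join it to the least neighbour in each component of the rest that it touches, and
-- recurse. These neighbours I are pairwise non-adjacent, so the star on {r} ∪ I against the
-- edgeless G[I] shows |I| ≤ DS; demanding degree ≤ DS at the vertices of I in the recursion (and
-- taking the next root among them) keeps every degree at most DS + 1.

module Submission where

open import Defs
open import Data.Nat using (ℕ)
open import Data.Rational using (ℚ; _≤_; _-_; 1ℚ)
open import Data.Product using (_×_)

open import Algebra.Bundles using (CommutativeMonoid)
import Algebra.Properties.CommutativeMonoid.Sum as Sum
import Relation.Binary.Reasoning.Setoid as ≈-Reasoning
open import Data.Bool using (Bool; true; false; _∧_; _∨_; not; if_then_else_; T)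
open import Data.Bool.Properties using (∧-conicalˡ; ∧-conicalʳ; ∧-assoc; ∧-identityʳ; ∧-zeroʳ)
  renaming (_≟_ to _≟ᵇ_)
open import Data.Empty using (⊥-elim)
open import Data.Fin using (Fin; zero; suc; toℕ; _≟_)
open import Data.Fin.Properties using (any?; toℕ-injective)
open import Data.List using (foldr; tabulate; allFin)
open import Data.List.Properties using (map-tabulate)
open import Data.Nat as ℕ using (zero; suc; _+_; z≤n; s≤s)
import Data.Nat.Properties as ℕ
import Data.Integer as ℤ
import Data.Integer.Properties as ℤ
open import Data.Product using (∃; _,_; proj₁; proj₂)
import Data.Rational as ℚ
open import Data.Rational using (0ℚ)
import Data.Rational.Properties as ℚ
import Data.Rational.Unnormalised as ℚᵘ
import Data.Rational.Unnormalised.Properties as ℚᵘ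
open import Data.Sum using (_⊎_; inj₁; inj₂)
import Data.Sum
open import Function using (_∘_)
open import Relation.Binary using (tri<; tri≈; tri>)
open import Relation.Binary.PropositionalEquality
open import Relation.Nullary using (¬_; yes; no)
open import Relation.Nullary.Decidable using (⌊_⌋)

private
  variable
    X : Set
    n : ℕ

∧-elimˡ : ∀ {a b} → a ∧ b ≡ true → a ≡ true
∧-elimˡ = ∧-conicalˡ _ _

∧-elimʳ : ∀ {a b} → a ∧ b ≡ true → b ≡ true
∧-elimʳ = ∧-conicalʳ _ _

∧-intro : ∀ {a b} → a ≡ true → b ≡ true → a ∧ b ≡ true
∧-intro refl refl = refl

∨-elim : ∀ {a b} → a ∨ b ≡ true → a ≡ true ⊎ b ≡ true
∨-elim {true}  _ = inj₁ refl
∨-elim {false} h = inj₂ h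

∨-introˡ : ∀ {a b} → a ≡ true → a ∨ b ≡ true
∨-introˡ refl = refl

∨-introʳ : ∀ {a b} → b ≡ true → a ∨ b ≡ true
∨-introʳ {true}  _ = refl
∨-introʳ {false} h = h

true≢false : ∀ {a} → a ≡ true → a ≢ false
true≢false refl ()

not-true : ∀ {b} → not b ≡ true → b ≡ false
not-true {false} _ = refl

≟⇒≡ : {i j : Fin n} → ⌊ i ≟ j ⌋ ≡ true → i ≡ j
≟⇒≡ {i = i} {j} h with i ≟ j
... | yes i≡j = i≡j

≟-refl : (i : Fin n) → ⌊ i ≟ i ⌋ ≡ true
≟-refl i with i ≟ i
... | yes _ = refl
... | no i≢i = ⊥-elim (i≢i refl)

≢⇒≟-false : {i j : Fin n} → i ≢ j → ⌊ i ≟ j ⌋ ≡ false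
≢⇒≟-false {i = i} {j} i≢j with i ≟ j
... | yes i≡j = ⊥-elim (i≢j i≡j)
... | no _    = refl

≟-false⇒≢ : {i j : Fin n} → ⌊ i ≟ j ⌋ ≡ false → i ≢ j
≟-false⇒≢ {i = i} h refl = true≢false (≟-refl i) h

≟-suc : (i j : Fin n) → ⌊ suc i ≟ suc j ⌋ ≡ ⌊ i ≟ j ⌋
≟-suc i j with i ≟ j
... | yes _ = refl
... | no _  = refl

<ᵇ⇒< : (i j : Fin n) → (i <ᵇ j) ≡ true → toℕ i ℕ.< toℕ j
<ᵇ⇒< i j h = ℕ.<ᵇ⇒< (toℕ i) (toℕ j) (subst T (sym h) _)

<⇒<ᵇ : (i j : Fin n) → toℕ i ℕ.< toℕ j → (i <ᵇ j) ≡ true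
<⇒<ᵇ i j h with toℕ i ℕ.<ᵇ toℕ j | ℕ.<⇒<ᵇ h
... | true | _ = refl

<ᵇ-irrefl : (i j : Fin n) → (i <ᵇ j) ≡ true → i ≢ j
<ᵇ-irrefl i j h refl = ℕ.<-irrefl refl (<ᵇ⇒< i j h)

<ᵇ-asym : (i j : Fin n) → (i <ᵇ j) ≡ true → (j <ᵇ i) ≢ true
<ᵇ-asym i j h h′ = ℕ.<-asym (<ᵇ⇒< i j h) (<ᵇ⇒< j i h′)

<ᵇ-total : (i j : Fin n) → i ≢ j → (i <ᵇ j) ≡ true ⊎ (j <ᵇ i) ≡ true
<ᵇ-total i j i≢j with ℕ.<-cmp (toℕ i) (toℕ j)
... | tri< i<j _ _ = inj₁ (<⇒<ᵇ i j i<j)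
... | tri≈ _ i≡j _ = ⊥-elim (i≢j (toℕ-injective i≡j))
... | tri> _ _ j<i = inj₂ (<⇒<ᵇ j i j<i)

orient : (p q : Fin n) → ∃ λ p′ → ∃ λ q′ →
  ∀ i j → (i <ᵇ j) ≡ true → (i ≡ p × j ≡ q) ⊎ (i ≡ q × j ≡ p) → i ≡ p′ × j ≡ q′
orient p q with p <ᵇ q in p<q
... | true  = p , q , ordered
  where
  ordered : ∀ i j → (i <ᵇ j) ≡ true → (i ≡ p × j ≡ q) ⊎ (i ≡ q × j ≡ p) → i ≡ p × j ≡ q
  ordered i j _   (inj₁ same)         = same
  ordered i j q<p (inj₂ (refl , refl)) = ⊥-elim (<ᵇ-asym p q p<q q<p)
... | false = q , p , ordered
  where
  ordered : ∀ i j → (i <ᵇ j) ≡ true → (i ≡ p × j ≡ q) ⊎ (i ≡ q × j ≡ p) → i ≡ q × j ≡ p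
  ordered i j p<q′ (inj₁ (refl , refl)) = ⊥-elim (true≢false p<q′ p<q)
  ordered i j _    (inj₂ swapped)       = swapped

module ℕΣ = Sum ℕ.+-0-commutativeMonoid
module ℚΣ = Sum ℚ.+-0-commutativeMonoid

_⊆_ : Subset n → Subset n → Set
A ⊆ B = ∀ i → A i ≡ true → B i ≡ true

_∩_ : Subset n → Subset n → Subset n
(A ∩ B) i = A i ∧ B i

_∪_ : Subset n → Subset n → Subset n
(A ∪ B) i = A i ∨ B i

_∖_ : Subset n → Subset n → Subset n
(A ∖ B) i = A i ∧ not (B i)

⁅_⁆ : Fin n → Subset n
⁅ a ⁆ i = ⌊ i ≟ a ⌋

full : Subset n
full _ = true

within : Subset n → Fin n → Fin n → Bool
within S i j = S i ∧ S j

incident : Fin n → Fin n → Fin n → Bool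
incident v i j = ⌊ i ≟ v ⌋ ∨ ⌊ j ≟ v ⌋

incident-elim : {v : Fin n} (i j : Fin n) → incident v i j ≡ true → i ≡ v ⊎ j ≡ v
incident-elim {v = v} i j h with ∨-elim {⌊ i ≟ v ⌋} h
... | inj₁ i≟v = inj₁ (≟⇒≡ i≟v)
... | inj₂ j≟v = inj₂ (≟⇒≡ j≟v)

isEdgeᵇ : EdgeRel n → Fin n → Fin n → Bool
isEdgeᵇ R i j = (i <ᵇ j) ∧ R i j

IsEdge-map : {R R′ : EdgeRel n} (i j : Fin n) → (R i j ≡ true → R′ i j ≡ true) →
  IsEdge R i j → IsEdge R′ i j
IsEdge-map i j f e = ∧-intro (∧-elimˡ {i <ᵇ j} e) (f (∧-elimʳ {i <ᵇ j} e))

Closed : EdgeRel n → Subset n → Set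
Closed R A = ∀ i j → IsEdge R i j → A i ≡ A j

Closed-∩ : {R : EdgeRel n} {S A : Subset n} → Closed R S → Closed R A → Closed R (S ∩ A)
Closed-∩ S-closed A-closed i j e = cong₂ _∧_ (S-closed i j e) (A-closed i j e)

Closed-∖ : {R : EdgeRel n} {S A : Subset n} → Closed R S → Closed R A → Closed R (S ∖ A)
Closed-∖ S-closed A-closed i j e = cong₂ (λ s a → s ∧ not a) (S-closed i j e) (A-closed i j e)

removeEdge-removes : (F : EdgeRel n) (p q : Fin n) → ¬ IsEdge (removeEdge F p q) p q
removeEdge-removes F p q e = true≢false (∧-elimʳ {p <ᵇ q} e) removed
  where
  removed : removeEdge F p q p q ≡ false
  removed rewrite ≟-refl p | ≟-refl q = ∧-zeroʳ (F p q)

removeEdge-⊆ : (F : EdgeRel n) (p q i j : Fin n) → IsEdge (removeEdge F p q) i j → IsEdge F i j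
removeEdge-⊆ F p q i j = IsEdge-map {R = removeEdge F p q} {R′ = F} i j (∧-elimˡ {F i j})

removeEdge-removes-pair : (R : EdgeRel n) {i j p q : Fin n} → IsEdge R i j →
  IsEdge (removeEdge R i j) p q → ¬ ((p ≡ i × q ≡ j) ⊎ (p ≡ j × q ≡ i))
removeEdge-removes-pair R {i} {j} ij e (inj₁ (refl , refl)) = removeEdge-removes R i j e
removeEdge-removes-pair R {i} {j} ij e (inj₂ (refl , refl)) =
  <ᵇ-asym i j (∧-elimˡ {i <ᵇ j} ij) (∧-elimˡ {j <ᵇ i} e)

∅ᴱ : EdgeRel n
∅ᴱ _ _ = false

∅ᴱ-no-edge : (i j : Fin n) → ¬ IsEdge ∅ᴱ i j
∅ᴱ-no-edge i j e = true≢false e (∧-zeroʳ (i <ᵇ j))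

module EdgeSums {c ℓ} (M : CommutativeMonoid c ℓ) where
  open CommutativeMonoid M using (Carrier; _≈_; _∙_; ε; identityˡ; identityʳ)
    renaming (setoid to ≈-setoid; refl to ≈-refl; sym to ≈-sym; trans to ≈-trans)
  open Sum M using (sum; sum-cong-≋; ∑-distrib-+; sum-replicate-zero)

  when : Bool → Carrier → Carrier
  when b x = if b then x else ε

  edgeTerm : EdgeRel n → (Fin n → Fin n → Bool) → (Fin n → Fin n → Carrier) →
    Fin n → Fin n → Carrier
  edgeTerm R P w i j = when (isEdgeᵇ R i j ∧ P i j) (w i j)

  edgeSum : EdgeRel n → (Fin n → Fin n → Bool) → (Fin n → Fin n → Carrier) → Carrier
  edgeSum R P w = sum λ i → sum (edgeTerm R P w i)

  when-split : ∀ e si sj ai aj x → (e ∧ (si ∧ sj) ≡ true → ai ≡ aj) →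
    when (e ∧ (si ∧ sj)) x ≈
    when (e ∧ ((si ∧ ai) ∧ (sj ∧ aj))) x ∙ when (e ∧ ((si ∧ not ai) ∧ (sj ∧ not aj))) x
  when-split false _     _     _     _     _ _ = ≈-sym (identityʳ ε)
  when-split true  false _     _     _     _ _ = ≈-sym (identityʳ ε)
  when-split true  true  false false _     _ _ = ≈-sym (identityʳ ε)
  when-split true  true  false true  _     _ _ = ≈-sym (identityʳ ε)
  when-split true  true  true  false false x _ = ≈-sym (identityˡ x)
  when-split true  true  true  true  true  x _ = ≈-sym (identityʳ x)
  when-split true  true  true  false true  _ h with () ← h refl
  when-split true  true  true  true  false _ h with () ← h refl

  edgeSum-split : ∀ {R : EdgeRel n} {A} T w →
    (∀ i j → IsEdge R i j → within T i j ≡ true → A i ≡ A j) →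
    edgeSum R (within T) w ≈ edgeSum R (within (T ∩ A)) w ∙ edgeSum R (within (T ∖ A)) w
  edgeSum-split {R = R} {A} T w closed = begin
    edgeSum R (within T) w                            ≈⟨ sum-cong-≋ (λ i → sum-cong-≋ (splits i)) ⟩
    sum (λ i → sum (λ j → inside i j ∙ outside i j))  ≈⟨ sum-cong-≋ (λ i → ∑-distrib-+ (inside i) (outside i)) ⟩
    sum (λ i → sum (inside i) ∙ sum (outside i))      ≈⟨ ∑-distrib-+ (sum ∘ inside) (sum ∘ outside) ⟩
    edgeSum R (within (T ∩ A)) w ∙ edgeSum R (within (T ∖ A)) w ∎
    where
    open ≈-Reasoning ≈-setoid
    inside outside : Fin _ → Fin _ → Carrier
    inside  = edgeTerm R (within (T ∩ A)) w
    outside = edgeTerm R (within (T ∖ A)) w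
    splits : ∀ i j → edgeTerm R (within T) w i j ≈ inside i j ∙ outside i j
    splits i j = when-split (isEdgeᵇ R i j) (T i) (T j) (A i) (A j) (w i j)
                   (λ h → closed i j (∧-elimˡ {isEdgeᵇ R i j} h) (∧-elimʳ {isEdgeᵇ R i j} h))

  edgeSum-none : ∀ {R : EdgeRel n} {P} w → (∀ i j → isEdgeᵇ R i j ∧ P i j ≡ false) → edgeSum R P w ≈ ε
  edgeSum-none {n} {R} {P} w none =
    ≈-trans (sum-cong-≋ λ i → ≈-trans (sum-cong-≋ λ j → nothing i j) (sum-replicate-zero n))
            (sum-replicate-zero n)
    where
    nothing : ∀ i j → edgeTerm R P w i j ≈ ε
    nothing i j rewrite none i j = ≈-refl

module ℕE = EdgeSums ℕ.+-0-commutativeMonoid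
module ℚE = EdgeSums ℚ.+-0-commutativeMonoid

𝟙 : Bool → ℕ
𝟙 b = if b then 1 else 0

size : Subset n → ℕ
size S = ℕΣ.sum (𝟙 ∘ S)

edgeCount : EdgeRel n → (Fin n → Fin n → Bool) → ℕ
edgeCount R P = ℕE.edgeSum R P (λ _ _ → 1)

degree : EdgeRel n → Fin n → ℕ
degree F v = edgeCount F (incident v)

𝟙≤1 : ∀ b → 𝟙 b ℕ.≤ 1
𝟙≤1 true  = ℕ.≤-refl
𝟙≤1 false = z≤n

𝟙-mono : ∀ {a b} → (a ≡ true → b ≡ true) → 𝟙 a ℕ.≤ 𝟙 b
𝟙-mono {false} _ = z≤n
𝟙-mono {true}  h rewrite h refl = ℕ.≤-refl

sum-mono : {f g : Fin n → ℕ} → (∀ i → f i ℕ.≤ g i) → ℕΣ.sum f ℕ.≤ ℕΣ.sum g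
sum-mono {zero}  _   = z≤n
sum-mono {suc n} f≤g = ℕ.+-mono-≤ (f≤g zero) (sum-mono (f≤g ∘ suc))

sum-zero : {f : Fin n → ℕ} → (∀ i → f i ≡ 0) → ℕΣ.sum f ≡ 0
sum-zero {n} f≗0 = trans (ℕΣ.sum-cong-≗ f≗0) (ℕΣ.sum-replicate-zero n)

term≤sum : (f : Fin n → ℕ) (i : Fin n) → f i ℕ.≤ ℕΣ.sum f
term≤sum f zero    = ℕ.m≤m+n _ _
term≤sum f (suc i) = ℕ.≤-trans (term≤sum (f ∘ suc) i) (ℕ.m≤n+m _ _)

sum-at : (a : Fin n) (g : Fin n → ℕ) → ℕΣ.sum (λ i → if ⌊ i ≟ a ⌋ then g i else 0) ≡ g a
sum-at {suc n} zero    g = trans (cong (g zero +_) (sum-zero {n} λ _ → refl)) (ℕ.+-identityʳ _)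
sum-at {suc n} (suc a) g =
  trans (ℕΣ.sum-cong-≗ λ i → cong (if_then g (suc i) else 0) (≟-suc i a)) (sum-at a (g ∘ suc))

size-⁅⁆ : (a : Fin n) → size ⁅ a ⁆ ≡ 1
size-⁅⁆ a = sum-at a (λ _ → 1)

size-≤ : (S : Subset n) → size S ℕ.≤ n
size-≤ {zero}  S = z≤n
size-≤ {suc n} S = ℕ.+-mono-≤ (𝟙≤1 (S zero)) (size-≤ (S ∘ suc))

size-pos : (S : Subset n) {a : Fin n} → S a ≡ true → 0 ℕ.< size S
size-pos S {a} Sa = ℕ.≤-trans (ℕ.≤-reflexive (cong 𝟙 (sym Sa))) (term≤sum (𝟙 ∘ S) a)

size-mono : {A B : Subset n} → A ⊆ B → size A ℕ.≤ size B
size-mono A⊆B = sum-mono λ i → 𝟙-mono (A⊆B i)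

size-split : (T A : Subset n) → size T ≡ size (T ∩ A) + size (T ∖ A)
size-split T A =
  trans (ℕΣ.sum-cong-≗ λ i → split (T i) (A i)) (ℕΣ.∑-distrib-+ (𝟙 ∘ (T ∩ A)) (𝟙 ∘ (T ∖ A)))
  where
  split : ∀ t a → 𝟙 t ≡ 𝟙 (t ∧ a) + 𝟙 (t ∧ not a)
  split false _     = refl
  split true  true  = refl
  split true  false = refl

size-insert : (B : Subset n) {w : Fin n} → B w ≡ false → size (B ∪ ⁅ w ⁆) ≡ suc (size B)
size-insert B {w} Bw = begin
  size (B ∪ ⁅ w ⁆)                     ≡⟨ ℕΣ.sum-cong-≗ point ⟩
  ℕΣ.sum (λ i → 𝟙 (B i) + 𝟙 (⁅ w ⁆ i)) ≡⟨ ℕΣ.∑-distrib-+ (𝟙 ∘ B) (𝟙 ∘ ⁅ w ⁆) ⟩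
  size B + size ⁅ w ⁆                  ≡⟨ cong (size B +_) (size-⁅⁆ w) ⟩
  size B + 1                           ≡⟨ ℕ.+-comm (size B) 1 ⟩
  suc (size B)                         ∎
  where
  open ≡-Reasoning
  point : ∀ i → 𝟙 (B i ∨ ⌊ i ≟ w ⌋) ≡ 𝟙 (B i) + 𝟙 ⌊ i ≟ w ⌋
  point i with i ≟ w | B i in Bi
  ... | yes refl | true  = ⊥-elim (true≢false Bi Bw)
  ... | yes refl | false = refl
  ... | no _     | true  = refl
  ... | no _     | false = refl

size-grow : {A B : Subset n} {w : Fin n} → A ⊆ B → B w ≡ true → A w ≡ false → size A ℕ.< size B
size-grow {A = A} {B} {w} A⊆B Bw Aw = subst (ℕ._≤ size B) (size-insert A Aw) (size-mono A∪w⊆B)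
  where
  A∪w⊆B : (A ∪ ⁅ w ⁆) ⊆ B
  A∪w⊆B i h with ∨-elim {A i} h
  ... | inj₁ Ai = A⊆B i Ai
  ... | inj₂ i≟w rewrite ≟⇒≡ i≟w = Bw

size-∩-< : (T A : Subset n) {b : Fin n} → (T ∖ A) b ≡ true → size (T ∩ A) ℕ.< size T
size-∩-< T A b∈ = subst (size (T ∩ A) ℕ.<_) (sym (size-split T A)) (ℕ.m<m+n _ (size-pos (T ∖ A) b∈))

size-∖-< : (T A : Subset n) {a : Fin n} → (T ∩ A) a ≡ true → size (T ∖ A) ℕ.< size T
size-∖-< T A a∈ = subst (size (T ∖ A) ℕ.<_) (sym (size-split T A)) (ℕ.m<n+m _ (size-pos (T ∩ A) a∈))

size≥2 : (S : Subset n) {i j : Fin n} → S i ≡ true → S j ≡ true → i ≢ j → 2 ℕ.≤ size S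
size≥2 S {i} {j} Si Sj i≢j =
  subst (ℕ._< size S) (size-⁅⁆ i) (size-grow ⁅i⁆⊆S Sj (≢⇒≟-false (i≢j ∘ sym)))
  where
  ⁅i⁆⊆S : ⁅ i ⁆ ⊆ S
  ⁅i⁆⊆S k h rewrite ≟⇒≡ h = Si

sum₂ : (Fin n → Fin n → ℕ) → ℕ
sum₂ f = ℕΣ.sum λ i → ℕΣ.sum (f i)

sum₂-mono : {f g : Fin n → Fin n → ℕ} → (∀ i j → f i j ℕ.≤ g i j) → sum₂ f ℕ.≤ sum₂ g
sum₂-mono f≤g = sum-mono λ i → sum-mono (f≤g i)

sum₂-+ : (f g : Fin n → Fin n → ℕ) → sum₂ (λ i j → f i j + g i j) ≡ sum₂ f + sum₂ g
sum₂-+ f g = trans (ℕΣ.sum-cong-≗ λ i → ℕΣ.∑-distrib-+ (f i) (g i))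
                   (ℕΣ.∑-distrib-+ (λ i → ℕΣ.sum (f i)) (λ i → ℕΣ.sum (g i)))

sum₂-pair : (p q : Fin n) → sum₂ (λ i j → 𝟙 (⌊ i ≟ p ⌋ ∧ ⌊ j ≟ q ⌋)) ≡ 1
sum₂-pair {n} p q = trans (ℕΣ.sum-cong-≗ row) (sum-at p (λ _ → 1))
  where
  row : ∀ i → ℕΣ.sum (λ j → 𝟙 (⌊ i ≟ p ⌋ ∧ ⌊ j ≟ q ⌋)) ≡ (if ⌊ i ≟ p ⌋ then 1 else 0)
  row i with ⌊ i ≟ p ⌋
  ... | true  = size-⁅⁆ q
  ... | false = sum-zero {n} λ _ → refl

edgeCount-mono : {R R′ : EdgeRel n} {P P′ : Fin n → Fin n → Bool} →
  (∀ i j → isEdgeᵇ R i j ∧ P i j ≡ true → isEdgeᵇ R′ i j ∧ P′ i j ≡ true) →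
  edgeCount R P ℕ.≤ edgeCount R′ P′
edgeCount-mono h = sum₂-mono λ i j → 𝟙-mono (h i j)

edgeCount-none : {R : EdgeRel n} {P : Fin n → Fin n → Bool} →
  (∀ i j → isEdgeᵇ R i j ∧ P i j ≡ false) → edgeCount R P ≡ 0
edgeCount-none = ℕE.edgeSum-none (λ _ _ → 1)

edgeCount≤1 : {R : EdgeRel n} {P : Fin n → Fin n → Bool} (p q : Fin n) →
  (∀ i j → isEdgeᵇ R i j ∧ P i j ≡ true → (i ≡ p × j ≡ q) ⊎ (i ≡ q × j ≡ p)) → edgeCount R P ℕ.≤ 1
edgeCount≤1 {R = R} {P} p q only-pq with orient p q
... | p′ , q′ , ordered =
  ℕ.≤-trans (sum₂-mono λ i j → 𝟙-mono (at-pair i j)) (ℕ.≤-reflexive (sum₂-pair p′ q′))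
  where
  at-pair : ∀ i j → isEdgeᵇ R i j ∧ P i j ≡ true → ⌊ i ≟ p′ ⌋ ∧ ⌊ j ≟ q′ ⌋ ≡ true
  at-pair i j h with ordered i j (∧-elimˡ {i <ᵇ j} (∧-elimˡ {isEdgeᵇ R i j} h)) (only-pq i j h)
  ... | refl , refl = ∧-intro (≟-refl i) (≟-refl j)

edgeCount-split : {R : EdgeRel n} (T A : Subset n) →
  (∀ i j → IsEdge R i j → within T i j ≡ true → A i ≡ A j) →
  edgeCount R (within T) ≡ edgeCount R (within (T ∩ A)) + edgeCount R (within (T ∖ A))
edgeCount-split T A = ℕE.edgeSum-split T (λ _ _ → 1)

edgeCount-∪ : (R R′ : EdgeRel n) (P : Fin n → Fin n → Bool) →
  edgeCount (λ i j → R i j ∨ R′ i j) P ℕ.≤ edgeCount R P + edgeCount R′ P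
edgeCount-∪ {n} R R′ P = begin
  edgeCount (λ i j → R i j ∨ R′ i j) P
    ≤⟨ sum₂-mono (λ i j → point (i <ᵇ j) (R i j) (R′ i j) (P i j)) ⟩
  sum₂ (λ i j → 𝟙 (isEdgeᵇ R i j ∧ P i j) + 𝟙 (isEdgeᵇ R′ i j ∧ P i j))
    ≡⟨ sum₂-+ {n} _ _ ⟩
  edgeCount R P + edgeCount R′ P ∎
  where
  open ℕ.≤-Reasoning
  point : ∀ l a b x → 𝟙 ((l ∧ (a ∨ b)) ∧ x) ℕ.≤ 𝟙 ((l ∧ a) ∧ x) + 𝟙 ((l ∧ b) ∧ x)
  point false _     _ _ = z≤n
  point true  true  _ x = ℕ.m≤m+n (𝟙 x) _
  point true  false _ _ = ℕ.≤-refl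

edgeCount-removeEdge : (R : EdgeRel n) (P : Fin n → Fin n → Bool) (p q : Fin n) →
  edgeCount R P ℕ.≤ suc (edgeCount (removeEdge R p q) P)
edgeCount-removeEdge {n} R P p q = begin
  edgeCount R P
    ≤⟨ sum₂-mono (λ i j → point (i <ᵇ j) (R i j) (P i j) (⌊ i ≟ p ⌋ ∧ ⌊ j ≟ q ⌋)) ⟩
  sum₂ (λ i j → 𝟙 (isEdgeᵇ (removeEdge R p q) i j ∧ P i j) + 𝟙 (⌊ i ≟ p ⌋ ∧ ⌊ j ≟ q ⌋))
    ≡⟨ sum₂-+ {n} _ _ ⟩
  edgeCount (removeEdge R p q) P + sum₂ (λ i j → 𝟙 (⌊ i ≟ p ⌋ ∧ ⌊ j ≟ q ⌋))
    ≡⟨ cong (edgeCount (removeEdge R p q) P +_) (sum₂-pair p q) ⟩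
  edgeCount (removeEdge R p q) P + 1
    ≡⟨ ℕ.+-comm _ 1 ⟩
  suc (edgeCount (removeEdge R p q) P) ∎
  where
  open ℕ.≤-Reasoning
  point : ∀ l r x c → 𝟙 ((l ∧ r) ∧ x) ℕ.≤ 𝟙 ((l ∧ (r ∧ not c)) ∧ x) + 𝟙 c
  point l     r     x true  = ℕ.≤-trans (𝟙≤1 _) (ℕ.m≤n+m 1 _)
  point l     true  x false = ℕ.m≤m+n _ 0
  point true  false x false = z≤n
  point false false x false = z≤n

within-mono : (R : EdgeRel n) {B B′ : Subset n} → B ⊆ B′ →
  ∀ i j → isEdgeᵇ R i j ∧ within B i j ≡ true → isEdgeᵇ R i j ∧ within B′ i j ≡ true
within-mono R {B} B⊆B′ i j h = ∧-intro (∧-elimˡ {isEdgeᵇ R i j} h)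
  (∧-intro (B⊆B′ i (∧-elimˡ {B i} Bij)) (B⊆B′ j (∧-elimʳ {B i} Bij)))
  where
  Bij = ∧-elimʳ {isEdgeᵇ R i j} h

edgeCount-within-mono : (R : EdgeRel n) {B B′ : Subset n} → B ⊆ B′ →
  edgeCount R (within B) ℕ.≤ edgeCount R (within B′)
edgeCount-within-mono R B⊆B′ = edgeCount-mono (within-mono R B⊆B′)

edgeCount-insert : (R : EdgeRel n) {B B′ : Subset n} {p q : Fin n} → B ⊆ B′ →
  IsEdge R p q → within B′ p q ≡ true → within B p q ≡ false →
  suc (edgeCount R (within B)) ℕ.≤ edgeCount R (within B′)
edgeCount-insert {n} R {B} {B′} {p} {q} B⊆B′ pq B′pq Bpq = begin
  suc (edgeCount R (within B))
    ≡⟨ ℕ.+-comm 1 _ ⟩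
  edgeCount R (within B) + 1
    ≡⟨ cong (edgeCount R (within B) +_) (sum₂-pair p q) ⟨
  edgeCount R (within B) + sum₂ (λ i j → 𝟙 (⌊ i ≟ p ⌋ ∧ ⌊ j ≟ q ⌋))
    ≡⟨ sum₂-+ {n} _ _ ⟨
  sum₂ (λ i j → 𝟙 (isEdgeᵇ R i j ∧ within B i j) + 𝟙 (⌊ i ≟ p ⌋ ∧ ⌊ j ≟ q ⌋))
    ≤⟨ sum₂-mono point ⟩
  edgeCount R (within B′) ∎
  where
  open ℕ.≤-Reasoning
  point : ∀ i j → 𝟙 (isEdgeᵇ R i j ∧ within B i j) + 𝟙 (⌊ i ≟ p ⌋ ∧ ⌊ j ≟ q ⌋)
                  ℕ.≤ 𝟙 (isEdgeᵇ R i j ∧ within B′ i j)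
  point i j with i ≟ p | j ≟ q
  ... | yes refl | yes refl rewrite pq | Bpq | B′pq = ℕ.≤-refl
  ... | yes _    | no _  = ℕ.≤-trans (ℕ.≤-reflexive (ℕ.+-identityʳ _)) (𝟙-mono (within-mono R B⊆B′ i j))
  ... | no _     | _     = ℕ.≤-trans (ℕ.≤-reflexive (ℕ.+-identityʳ _)) (𝟙-mono (within-mono R B⊆B′ i j))

sumList-tabulate : (h : Fin n → X) (f : X → ℚ) → sumList (tabulate h) f ≡ ℚΣ.sum (f ∘ h)
sumList-tabulate {zero}  h f = refl
sumList-tabulate {suc n} h f = cong (f (h zero) ℚ.+_) (sumList-tabulate (h ∘ suc) f)

countList-tabulate : (h : Fin n → X) (p : X → Bool) → countList (tabulate h) p ≡ size (p ∘ h)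
countList-tabulate {zero}  h p = refl
countList-tabulate {suc n} h p with p (h zero)
... | true  = cong suc (countList-tabulate (h ∘ suc) p)
... | false = countList-tabulate (h ∘ suc) p

foldr-+-tabulate : (h : Fin n → ℕ) → foldr _+_ 0 (tabulate h) ≡ ℕΣ.sum h
foldr-+-tabulate {zero}  h = refl
foldr-+-tabulate {suc n} h = cong (h zero +_) (foldr-+-tabulate (h ∘ suc))

sumList-allFin : (f : Fin n → ℚ) → sumList (allFin n) f ≡ ℚΣ.sum f
sumList-allFin f = sumList-tabulate (λ i → i) f

countList-allFin : (p : Fin n → Bool) → countList (allFin n) p ≡ size p
countList-allFin p = countList-tabulate (λ i → i) p

card≡size : (S : Subset n) → card S ≡ size S
card≡size = countList-allFin

numEdges≡edgeCount : (R : EdgeRel n) → numEdges R ≡ edgeCount R allPairs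
numEdges≡edgeCount {n} R = begin
  numEdges R
    ≡⟨ cong (foldr _+_ 0) (map-tabulate (λ i → i) row) ⟩
  foldr _+_ 0 (tabulate row)
    ≡⟨ foldr-+-tabulate row ⟩
  ℕΣ.sum row
    ≡⟨ ℕΣ.sum-cong-≗ (λ i → countList-allFin (isEdgeᵇ R i)) ⟩
  sum₂ (λ i j → 𝟙 (isEdgeᵇ R i j))
    ≡⟨ ℕΣ.sum-cong-≗ (λ i → ℕΣ.sum-cong-≗ λ j → cong 𝟙 (sym (∧-identityʳ (isEdgeᵇ R i j)))) ⟩
  edgeCount R allPairs ∎
  where
  open ≡-Reasoning
  row : Fin n → ℕ
  row i = countList (allFin n) (isEdgeᵇ R i)

numEdges-∅ᴱ : numEdges {n} ∅ᴱ ≡ 0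
numEdges-∅ᴱ {n} =
  trans (numEdges≡edgeCount {n} ∅ᴱ) (edgeCount-none {n} λ i j → cong (_∧ true) (∧-zeroʳ (i <ᵇ j)))

sumEdges≡edgeSum : (R : EdgeRel n) (P : Fin n → Fin n → Bool) (x : Fin n → Fin n → ℚ) →
  sumEdges R P x ≡ ℚE.edgeSum R P x
sumEdges≡edgeSum {n} R P x =
  trans (sumList-allFin (λ i → sumList (allFin n) (term i))) (ℚΣ.sum-cong-≗ λ i →
    trans (sumList-allFin (term i)) (ℚΣ.sum-cong-≗ λ j →
      cong (if_then x i j else 0ℚ) (sym (∧-assoc (i <ᵇ j) (R i j) (P i j)))))
  where
  term : Fin n → Fin n → ℚ
  term i j = if (i <ᵇ j) ∧ R i j ∧ P i j then x i j else 0ℚ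

toℚᵘ-ℕtoℚ : ∀ k → ℚ.toℚᵘ (ℕtoℚ k) ℚᵘ.≃ ℚᵘ.mkℚᵘ (ℤ.+ k) 0
toℚᵘ-ℕtoℚ k = ℚ.toℚᵘ-fromℚᵘ (ℚᵘ.mkℚᵘ (ℤ.+ k) 0)

ℕtoℚ-+ : ∀ a b → ℕtoℚ (a + b) ≡ ℕtoℚ a ℚ.+ ℕtoℚ b
ℕtoℚ-+ a b = ℚ.toℚᵘ-injective (begin-equality
  ℚ.toℚᵘ (ℕtoℚ (a + b))                         ≃⟨ toℚᵘ-ℕtoℚ (a + b) ⟩
  ℚᵘ.mkℚᵘ (ℤ.+ (a + b)) 0                       ≃⟨ ℚᵘ.*≡* (cong (ℤ._* ℤ.+ 1) (sym (cong₂ ℤ._+_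
                                                      (ℤ.*-identityʳ (ℤ.+ a)) (ℤ.*-identityʳ (ℤ.+ b))))) ⟩
  ℚᵘ.mkℚᵘ (ℤ.+ a) 0 ℚᵘ.+ ℚᵘ.mkℚᵘ (ℤ.+ b) 0      ≃⟨ ℚᵘ.+-cong (toℚᵘ-ℕtoℚ a) (toℚᵘ-ℕtoℚ b) ⟨
  ℚ.toℚᵘ (ℕtoℚ a) ℚᵘ.+ ℚ.toℚᵘ (ℕtoℚ b)          ≃⟨ ℚ.toℚᵘ-homo-+ (ℕtoℚ a) (ℕtoℚ b) ⟨
  ℚ.toℚᵘ (ℕtoℚ a ℚ.+ ℕtoℚ b)                    ∎)
  where open ℚᵘ.≤-Reasoning

ℕtoℚ-mono : ∀ {a b} → a ℕ.≤ b → ℕtoℚ a ≤ ℕtoℚ b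
ℕtoℚ-mono {a} {b} a≤b = ℚ.toℚᵘ-cancel-≤ (begin
  ℚ.toℚᵘ (ℕtoℚ a)    ≃⟨ toℚᵘ-ℕtoℚ a ⟩
  ℚᵘ.mkℚᵘ (ℤ.+ a) 0  ≤⟨ ℚᵘ.*≤* (subst₂ ℤ._≤_ (sym (ℤ.*-identityʳ (ℤ.+ a))) (sym (ℤ.*-identityʳ (ℤ.+ b)))
                          (ℤ.+≤+ a≤b)) ⟩
  ℚᵘ.mkℚᵘ (ℤ.+ b) 0  ≃⟨ toℚᵘ-ℕtoℚ b ⟨
  ℚ.toℚᵘ (ℕtoℚ b)    ∎)
  where open ℚᵘ.≤-Reasoning

sum-ℕtoℚ : (f : Fin n → ℕ) → ℚΣ.sum (ℕtoℚ ∘ f) ≡ ℕtoℚ (ℕΣ.sum f)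
sum-ℕtoℚ {zero}  f = refl
sum-ℕtoℚ {suc n} f =
  trans (cong (ℕtoℚ (f zero) ℚ.+_) (sum-ℕtoℚ (f ∘ suc))) (sym (ℕtoℚ-+ (f zero) _))

ℕtoℚ-suc : ∀ k → ℕtoℚ (suc k) ≡ ℕtoℚ k ℚ.+ 1ℚ
ℕtoℚ-suc k = trans (cong ℕtoℚ (ℕ.+-comm 1 k)) (ℕtoℚ-+ k 1)

p+r-r≡p : ∀ p r → p ℚ.+ r - r ≡ p
p+r-r≡p p r = trans (ℚ.+-assoc p r (ℚ.- r)) (trans (cong (p ℚ.+_) (ℚ.+-inverseʳ r)) (ℚ.+-identityʳ p))

p-r+r≡p : ∀ p r → p - r ℚ.+ r ≡ p
p-r+r≡p p r = trans (ℚ.+-assoc p (ℚ.- r) r) (trans (cong (p ℚ.+_) (ℚ.+-inverseˡ r)) (ℚ.+-identityʳ p))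

≤-1⇒+1≤ : ∀ {p q} → p ≤ q - 1ℚ → p ℚ.+ 1ℚ ≤ q
≤-1⇒+1≤ {p} {q} h = subst (p ℚ.+ 1ℚ ≤_) (p-r+r≡p q 1ℚ) (ℚ.+-monoˡ-≤ 1ℚ h)

ℕtoℚ-≤-suc : ∀ {a b} → a ℕ.≤ suc b → ℕtoℚ a - 1ℚ ≤ ℕtoℚ b
ℕtoℚ-≤-suc {a} {b} h = subst (ℕtoℚ a - 1ℚ ≤_) (p+r-r≡p (ℕtoℚ b) 1ℚ)
  (ℚ.+-monoˡ-≤ (ℚ.- 1ℚ) (subst (ℕtoℚ a ≤_) (ℕtoℚ-suc b) (ℕtoℚ-mono h)))

ℕtoℚ-< : ∀ {a b} → a ℕ.< b → ℕtoℚ a ≤ ℕtoℚ b - 1ℚ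
ℕtoℚ-< {a} {b} h = subst (_≤ ℕtoℚ b - 1ℚ) (p+r-r≡p (ℕtoℚ a) 1ℚ)
  (ℚ.+-monoˡ-≤ (ℚ.- 1ℚ) (subst (_≤ ℕtoℚ b) (ℕtoℚ-suc a) (ℕtoℚ-mono h)))

indicator : EdgeRel n → Fin n → Fin n → ℚ
indicator F i j = if F i j then 1ℚ else 0ℚ

sumEdges-indicator : {R F : EdgeRel n} (P : Fin n → Fin n → Bool) →
  (∀ i j → IsEdge F i j → IsEdge R i j) → sumEdges R P (indicator F) ≡ ℕtoℚ (edgeCount F P)
sumEdges-indicator {n} {R} {F} P F⊆R = begin
  sumEdges R P (indicator F)
    ≡⟨ sumEdges≡edgeSum R P (indicator F) ⟩
  ℚΣ.sum (λ i → ℚΣ.sum λ j → ℚE.edgeTerm R P (indicator F) i j)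
    ≡⟨ ℚΣ.sum-cong-≗ (λ i → trans (ℚΣ.sum-cong-≗ (λ j → point (i <ᵇ j) (R i j) (F i j) (P i j) (F⊆R i j)))
                                  (sum-ℕtoℚ λ j → 𝟙 (isEdgeᵇ F i j ∧ P i j))) ⟩
  ℚΣ.sum (λ i → ℕtoℚ (ℕΣ.sum λ j → 𝟙 (isEdgeᵇ F i j ∧ P i j)))
    ≡⟨ sum-ℕtoℚ (λ i → ℕΣ.sum λ j → 𝟙 (isEdgeᵇ F i j ∧ P i j)) ⟩
  ℕtoℚ (edgeCount F P) ∎
  where
  open ≡-Reasoning
  point : ∀ l r f p → (l ∧ f ≡ true → l ∧ r ≡ true) →
    ℚE.when ((l ∧ r) ∧ p) (if f then 1ℚ else 0ℚ) ≡ ℕtoℚ (𝟙 ((l ∧ f) ∧ p))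
  point false _     _     _     _ = refl
  point true  true  true  true  _ = refl
  point true  true  true  false _ = refl
  point true  true  false true  _ = refl
  point true  true  false false _ = refl
  point true  false false _     _ = refl
  point true  false true  _     h with () ← h refl

adjᵇ : EdgeRel n → Fin n → Fin n → Bool
adjᵇ R v w = isEdgeᵇ R v w ∨ isEdgeᵇ R w v

adjᵇ⇒Adj : {R : EdgeRel n} (v w : Fin n) → adjᵇ R v w ≡ true → Adj R v w
adjᵇ⇒Adj {R = R} v w h = ∨-elim {isEdgeᵇ R v w} h

Adj⇒adjᵇ : {R : EdgeRel n} (v w : Fin n) → Adj R v w → adjᵇ R v w ≡ true
Adj⇒adjᵇ v w (inj₁ e) = ∨-introˡ e
Adj⇒adjᵇ {R = R} v w (inj₂ e) = ∨-introʳ {isEdgeᵇ R v w} e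

Adj-sym : {R : EdgeRel n} (v w : Fin n) → Adj R v w → Adj R w v
Adj-sym v w (inj₁ e) = inj₂ e
Adj-sym v w (inj₂ e) = inj₁ e

Closed-Adj : {R : EdgeRel n} {A : Subset n} → Closed R A → ∀ {v w} → Adj R v w → A v ≡ A w
Closed-Adj closed (inj₁ e) = closed _ _ e
Closed-Adj closed (inj₂ e) = sym (closed _ _ e)

Closed-Walk : {R : EdgeRel n} {A : Subset n} → Closed R A → ∀ {u w} → Walk R u w → A u ≡ A w
Closed-Walk closed here       = refl
Closed-Walk closed (step a p) = trans (Closed-Adj closed a) (Closed-Walk closed p)

_++ʷ_ : {R : EdgeRel n} {u v w : Fin n} → Walk R u v → Walk R v w → Walk R u w
here       ++ʷ q = q
step a p   ++ʷ q = step a (p ++ʷ q)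

Walk-reverse : {R : EdgeRel n} {u w : Fin n} → Walk R u w → Walk R w u
Walk-reverse here       = here
Walk-reverse {R = R} (step {u} {v} a p) = Walk-reverse p ++ʷ step (Adj-sym {R = R} u v a) here

Walk-map : {R R′ : EdgeRel n} → (∀ i j → IsEdge R i j → IsEdge R′ i j) →
  ∀ {u w} → Walk R u w → Walk R′ u w
Walk-map f here                = here
Walk-map f (step (inj₁ e) p)   = step (inj₁ (f _ _ e)) (Walk-map f p)
Walk-map f (step (inj₂ e) p)   = step (inj₂ (f _ _ e)) (Walk-map f p)

isolated⇒stuck : {R : EdgeRel n} {c u : Fin n} → (∀ q → ¬ Adj R c q) → Walk R c u → c ≡ u
isolated⇒stuck isolated here         = refl
isolated⇒stuck isolated (step a _)   = ⊥-elim (isolated _ a)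

removeEdge-isolates : {R : EdgeRel n} {i j c : Fin n} → IsEdge R i j →
  (∀ p q → IsEdge R p q → p ≡ c ⊎ q ≡ c → (p ≡ i × q ≡ j) ⊎ (p ≡ j × q ≡ i)) →
  ∀ q → ¬ Adj (removeEdge R i j) c q
removeEdge-isolates {R = R} {i} {j} {c} ij only-ij q (inj₁ e) =
  removeEdge-removes-pair R ij e (only-ij c q (removeEdge-⊆ R i j c q e) (inj₁ refl))
removeEdge-isolates {R = R} {i} {j} {c} ij only-ij q (inj₂ e) =
  removeEdge-removes-pair R ij e (only-ij q c (removeEdge-⊆ R i j q c e) (inj₂ refl))

⊆-or-witness : (X Y : Subset n) → X ⊆ Y ⊎ ∃ λ w → X w ≡ true × Y w ≡ false
⊆-or-witness X Y with any? (λ w → X w ∧ not (Y w) ≟ᵇ true)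
... | yes (w , h) = inj₂ (w , ∧-elimˡ h , not-true (∧-elimʳ {X w} h))
... | no ∄w = inj₁ λ w Xw → lemma w Xw
  where
  lemma : ∀ w → X w ≡ true → Y w ≡ true
  lemma w Xw with Y w in Yw
  ... | true  = refl
  ... | false = ⊥-elim (∄w (w , cong₂ (λ x y → x ∧ not y) Xw Yw))

empty-or-witness : (S : Subset n) → (∀ i → S i ≡ false) ⊎ ∃ λ i → S i ≡ true
empty-or-witness S with any? (λ i → S i ≟ᵇ true)
... | yes found = inj₂ found
... | no ∄i     = inj₁ λ i → lemma i
  where
  lemma : ∀ i → S i ≡ false
  lemma i with S i in Si
  ... | true  = ⊥-elim (∄i (i , Si))
  ... | false = refl

none-or-witness₂ : (P : Fin n → Fin n → Bool) →
  (∀ i j → P i j ≡ false) ⊎ ∃ λ i → ∃ λ j → P i j ≡ true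
none-or-witness₂ P with any? (λ i → any? (λ j → P i j ≟ᵇ true))
... | yes found = inj₂ found
... | no ∄ij    = inj₁ λ i j → lemma i j
  where
  lemma : ∀ i j → P i j ≡ false
  lemma i j with P i j in Pij
  ... | true  = ⊥-elim (∄ij (i , j , Pij))
  ... | false = refl

expand : EdgeRel n → Subset n → Subset n
expand R A w = A w ∨ ⌊ any? (λ v → A v ∧ adjᵇ R v w ≟ᵇ true) ⌋

module _ {R : EdgeRel n} where

  expand-elim : ∀ {A} w → expand R A w ≡ true → A w ≡ true ⊎ ∃ λ v → A v ≡ true × Adj R v w
  expand-elim {A} w h with ∨-elim {A w} h
  ... | inj₁ Aw = inj₁ Aw
  ... | inj₂ found with any? (λ v → A v ∧ adjᵇ R v w ≟ᵇ true)
  ...   | yes (v , h′) = inj₂ (v , ∧-elimˡ h′ , adjᵇ⇒Adj {R = R} v w (∧-elimʳ {A v} h′))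

  expand-intro : ∀ {A v w} → A v ≡ true → Adj R v w → expand R A w ≡ true
  expand-intro {A} {v} {w} Av a = ∨-introʳ {A w} found
    where
    found : ⌊ any? (λ v → A v ∧ adjᵇ R v w ≟ᵇ true) ⌋ ≡ true
    found with any? (λ v → A v ∧ adjᵇ R v w ≟ᵇ true)
    ... | yes _  = refl
    ... | no ∄v = ⊥-elim (∄v (v , ∧-intro Av (Adj⇒adjᵇ {R = R} v w a)))

  ⊆-expand : ∀ A → A ⊆ expand R A
  ⊆-expand A w Aw = ∨-introˡ Aw

  expand-mono : ∀ {A B} → A ⊆ B → expand R A ⊆ expand R B
  expand-mono A⊆B w h with expand-elim w h
  ... | inj₁ Aw            = ⊆-expand _ w (A⊆B w Aw)
  ... | inj₂ (v , Av , a)  = expand-intro (A⊆B v Av) a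

  expand-least : ∀ {A B} → Closed R B → A ⊆ B → expand R A ⊆ B
  expand-least closed A⊆B w h with expand-elim w h
  ... | inj₁ Aw            = A⊆B w Aw
  ... | inj₂ (v , Av , a)  = trans (sym (Closed-Adj closed a)) (A⊆B v Av)

  expand-stable⇒Closed : ∀ {A} → expand R A ⊆ A → Closed R A
  expand-stable⇒Closed {A} stable i j e with A i in Ai | A j in Aj
  ... | true  | true  = refl
  ... | false | false = refl
  ... | true  | false = sym (trans (sym Aj) (stable j (expand-intro Ai (inj₁ e))))
  ... | false | true  = trans (sym Ai) (stable i (expand-intro Aj (inj₂ e)))

  reach : ℕ → Subset n → Subset n
  reach zero    A = A
  reach (suc k) A = expand R (reach k A)

  ⊆-reach : ∀ k A → A ⊆ reach k A
  ⊆-reach zero    A = λ _ h → h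
  ⊆-reach (suc k) A = λ w h → ⊆-expand _ w (⊆-reach k A w h)

  reach-least : ∀ k {A B} → Closed R B → A ⊆ B → reach k A ⊆ B
  reach-least zero    closed A⊆B = A⊆B
  reach-least (suc k) closed A⊆B = expand-least closed (reach-least k closed A⊆B)

  reach-Walk : ∀ k u w → reach k ⁅ u ⁆ w ≡ true → Walk R u w
  reach-Walk zero    u w h rewrite ≟⇒≡ h = here
  reach-Walk (suc k) u w h with expand-elim w h
  ... | inj₁ reached         = reach-Walk k u w reached
  ... | inj₂ (v , Rv , a)    = reach-Walk k u v Rv ++ʷ step a here

  reach-stable-or-large : ∀ k A → reach (suc k) A ⊆ reach k A ⊎ suc k ℕ.≤ size (reach (suc k) A)
  reach-stable-or-large k A with ⊆-or-witness (reach (suc k) A) (reach k A)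
  ... | inj₁ stable = inj₁ stable
  ... | inj₂ (w , new , old) with k
  ...   | zero  = inj₂ (size-pos (reach 1 A) new)
  ...   | suc k′ with reach-stable-or-large k′ A
  ...     | inj₁ stable = inj₁ (expand-mono stable)
  ...     | inj₂ large  = inj₂ (ℕ.<-≤-trans (s≤s large) (size-grow (⊆-expand _) new old))

  -- Each step either is stable or adds a vertex, and there are only n vertices.
  reach-Closed : ∀ A → Closed R (reach n A)
  reach-Closed A with reach-stable-or-large n A
  ... | inj₁ stable = expand-stable⇒Closed stable
  ... | inj₂ large  = ⊥-elim (ℕ.<-irrefl refl (ℕ.≤-trans large (size-≤ _)))

component : EdgeRel n → Fin n → Subset n
component {n} R u = reach {R = R} n ⁅ u ⁆

module _ (R : EdgeRel n) where

  component-Closed : ∀ u → Closed R (component R u)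
  component-Closed u = reach-Closed ⁅ u ⁆

  component-self : ∀ u → component R u u ≡ true
  component-self u = ⊆-reach n ⁅ u ⁆ u (≟-refl u)

  component-least : ∀ {B} u → Closed R B → B u ≡ true → component R u ⊆ B
  component-least {B} u closed Bu =
    reach-least n closed λ w h → subst (λ x → B x ≡ true) (sym (≟⇒≡ h)) Bu

  component⇒Walk : ∀ u w → component R u w ≡ true → Walk R u w
  component⇒Walk = reach-Walk n

  Walk⇒component : ∀ {u w} → Walk R u w → component R u w ≡ true
  Walk⇒component {u} p = trans (sym (Closed-Walk (component-Closed u) p)) (component-self u)

  component-sym : ∀ u w → component R u w ≡ true → component R w u ≡ true
  component-sym u w h = Walk⇒component (Walk-reverse (component⇒Walk u w h))

  component-trans : ∀ u v w → component R u v ≡ true → component R v w ≡ true → component R u w ≡ true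
  component-trans u v w h h′ = Walk⇒component (component⇒Walk u v h ++ʷ component⇒Walk v w h′)

Independent : EdgeRel n → Set
Independent {n} F = (T : Subset n) → 0 ℕ.< size T → edgeCount F (within T) ℕ.< size T

record Cut (F : EdgeRel n) (T : Subset n) : Set where
  field
    side     : Subset n
    p q      : Fin n
    inside   : ∃ λ a → (T ∩ side) a ≡ true
    outside  : ∃ λ b → (T ∖ side) b ≡ true
    crossing : ∀ i j → IsEdge F i j → within T i j ≡ true →
               side i ≡ side j ⊎ (i ≡ p × j ≡ q) ⊎ (i ≡ q × j ≡ p)

  oriented : ∃ λ p′ → ∃ λ q′ →
    ∀ i j → IsEdge (removeEdge F p′ q′) i j → within T i j ≡ true → side i ≡ side j
  oriented with orient p q
  ... | p′ , q′ , ordered =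
    p′ , q′ , λ i j e Tij → uncrossed i j e (crossing i j (removeEdge-⊆ F p′ q′ i j e) Tij)
    where
    uncrossed : ∀ i j → IsEdge (removeEdge F p′ q′) i j →
      side i ≡ side j ⊎ (i ≡ p × j ≡ q) ⊎ (i ≡ q × j ≡ p) → side i ≡ side j
    uncrossed i j e (inj₁ same) = same
    uncrossed i j e (inj₂ pair) with ordered i j (∧-elimˡ {i <ᵇ j} e) pair
    ... | refl , refl = ⊥-elim (removeEdge-removes F p′ q′ e)

-- Splitting T along a cut loses at most the edge {p,q}, so the bound |F[T]| < |T|
-- follows from the same bound on both sides.
independent-by-cuts : (F : EdgeRel n) →
  (∀ T → 0 ℕ.< size T → edgeCount F (within T) ℕ.< size T ⊎ Cut F T) → Independent F
independent-by-cuts {n} F small-or-cut T pos = go (size T) T ℕ.≤-refl pos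
  where
  go : ∀ m T → size T ℕ.≤ m → 0 ℕ.< size T → edgeCount F (within T) ℕ.< size T
  go zero    T size≤ pos = ⊥-elim (ℕ.<-irrefl refl (ℕ.<-≤-trans pos size≤))
  go (suc m) T size≤ pos with small-or-cut T pos
  ... | inj₁ small = small
  ... | inj₂ cut with Cut.oriented cut
  ...   | p , q , crossing = begin
    suc (e T)                                   ≤⟨ s≤s (edgeCount-removeEdge F (within T) p q) ⟩
    suc (suc (e′ T))                            ≡⟨ cong (λ k → suc (suc k)) (edgeCount-split T side crossing) ⟩
    suc (suc (e′ (T ∩ side) + e′ (T ∖ side)))   ≤⟨ s≤s (s≤s (ℕ.+-mono-≤ (e′≤e (T ∩ side)) (e′≤e (T ∖ side)))) ⟩
    suc (suc (e (T ∩ side) + e (T ∖ side)))     ≡⟨ cong suc (ℕ.+-suc _ _) ⟨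
    suc (e (T ∩ side)) + suc (e (T ∖ side))     ≤⟨ ℕ.+-mono-≤ (go m (T ∩ side) (part (size-∩-< T side b∈)) (size-pos (T ∩ side) a∈))
                                                              (go m (T ∖ side) (part (size-∖-< T side a∈)) (size-pos (T ∖ side) b∈)) ⟩
    size (T ∩ side) + size (T ∖ side)           ≡⟨ size-split T side ⟨
    size T                                      ∎
    where
    open ℕ.≤-Reasoning
    open Cut cut using (side; inside; outside)
    F′ = removeEdge F p q
    e e′ : Subset n → ℕ
    e  X = edgeCount F (within X)
    e′ X = edgeCount F′ (within X)
    e′≤e : ∀ X → e′ X ℕ.≤ e X
    e′≤e X = edgeCount-mono λ i j h →
      ∧-intro (removeEdge-⊆ F p q i j (∧-elimˡ {isEdgeᵇ F′ i j} h)) (∧-elimʳ {isEdgeᵇ F′ i j} h)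
    a∈ = proj₂ inside
    b∈ = proj₂ outside
    part : ∀ {k} → k ℕ.< size T → k ℕ.≤ m
    part k< = ℕ.≤-pred (ℕ.≤-trans k< size≤)

-- For an edge {a,b} of F inside T, the component of a in (F - ab)[T] does not contain b.
acyclic⇒independent : {F : EdgeRel n} → (∀ i j → IsEdge F i j → ¬ Walk (removeEdge F i j) i j) →
  Independent F
acyclic⇒independent {n} {F} acyclic = independent-by-cuts F small-or-cut
  where
  small-or-cut : ∀ T → 0 ℕ.< size T → edgeCount F (within T) ℕ.< size T ⊎ Cut F T
  small-or-cut T pos with none-or-witness₂ (λ i j → isEdgeᵇ F i j ∧ within T i j)
  ... | inj₁ none = inj₁ (subst (ℕ._< size T) (sym (edgeCount-none none)) pos)
  ... | inj₂ (a , b , ab∈T) = inj₂ (record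
    { side     = A
    ; p        = a
    ; q        = b
    ; inside   = a , ∧-intro (∧-elimˡ {T a} Tab) (component-self F′ a)
    ; outside  = b , ∧-intro (∧-elimʳ {T a} Tab) (cong not Ab)
    ; crossing = crossing
    })
    where
    Tab : within T a b ≡ true
    Tab = ∧-elimʳ {isEdgeᵇ F a b} ab∈T
    F′ : EdgeRel n
    F′ i j = removeEdge F a b i j ∧ within T i j
    A : Subset n
    A = component F′ a
    F′⊆F-ab : ∀ i j → IsEdge F′ i j → IsEdge (removeEdge F a b) i j
    F′⊆F-ab i j = IsEdge-map {R = F′} {R′ = removeEdge F a b} i j (∧-elimˡ {removeEdge F a b i j})
    Ab : A b ≡ false
    Ab with A b in Ab
    ... | false = refl
    ... | true  = ⊥-elim (acyclic a b (∧-elimˡ {isEdgeᵇ F a b} ab∈T)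
                                      (Walk-map F′⊆F-ab (component⇒Walk F′ a b Ab)))
    crossing : ∀ i j → IsEdge F i j → within T i j ≡ true →
               A i ≡ A j ⊎ (i ≡ a × j ≡ b) ⊎ (i ≡ b × j ≡ a)
    crossing i j e Tij with ⌊ i ≟ a ⌋ ∧ ⌊ j ≟ b ⌋ in ij≟ab
    ... | true  = inj₂ (inj₁ (≟⇒≡ (∧-elimˡ {⌊ i ≟ a ⌋} ij≟ab) , ≟⇒≡ (∧-elimʳ {⌊ i ≟ a ⌋} ij≟ab)))
    ... | false = inj₁ (component-Closed F′ a i j
                    (IsEdge-map {R = F} {R′ = F′} i j
                       (λ Fij → ∧-intro (∧-intro Fij (cong not ij≟ab)) Tij) e))

-- Growing a set one vertex at a time along edges adds at least one edge per vertex.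
connected⇒size≤edges : (H : EdgeRel n) {S : Subset n} {a : Fin n} →
  Closed H S → S a ≡ true → S ⊆ component H a → size S ℕ.≤ suc (edgeCount H (within S))
connected⇒size≤edges {n} H {S} {a} S-closed Sa S⊆Ca =
  go (size S) ⁅ a ⁆ ⁅a⁆⊆S (≟-refl a) (ℕ.m≤m+n (size S) _)
     (subst (ℕ._≤ suc (edgeCount H (within ⁅ a ⁆))) (sym (size-⁅⁆ a)) (s≤s z≤n))
  where
  Tight : Subset n → Set
  Tight B = size B ℕ.≤ suc (edgeCount H (within B))

  ⁅a⁆⊆S : ⁅ a ⁆ ⊆ S
  ⁅a⁆⊆S i h rewrite ≟⇒≡ h = Sa

  Grown : Subset n → Subset n → Set
  Grown B B′ = B′ ⊆ S × B′ a ≡ true × size B′ ≡ suc (size B) × Tight B′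

  extend : ∀ B → B ⊆ S → B a ≡ true → Tight B → S ⊆ B ⊎ ∃ (Grown B)
  extend B B⊆S Ba B-tight with ⊆-or-witness (expand H B) B
  ... | inj₁ stable =
    inj₁ λ i Si → component-least H a (expand-stable⇒Closed stable) Ba i (S⊆Ca i Si)
  ... | inj₂ (w , new , old) with expand-elim {R = H} w new
  ...   | inj₁ Bw = ⊥-elim (true≢false Bw old)
  ...   | inj₂ (v , Bv , vw) = inj₂ (B′ , B′⊆S , ∨-introˡ Ba , size-insert B old , B′-tight)
    where
    B′ = B ∪ ⁅ w ⁆
    B′⊆S : B′ ⊆ S
    B′⊆S i h with ∨-elim {B i} h
    ... | inj₁ Bi = B⊆S i Bi
    ... | inj₂ i≟w rewrite ≟⇒≡ i≟w = trans (sym (Closed-Adj S-closed {v} {w} vw)) (B⊆S v Bv)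
    B⊆B′ : B ⊆ B′
    B⊆B′ i = ∨-introˡ
    B′v : B′ v ≡ true
    B′v = ∨-introˡ Bv
    B′w : B′ w ≡ true
    B′w = ∨-introʳ {B w} (≟-refl w)
    more-edges : Adj H v w → suc (edgeCount H (within B)) ℕ.≤ edgeCount H (within B′)
    more-edges (inj₁ e) = edgeCount-insert H B⊆B′ e (∧-intro B′v B′w) (cong₂ _∧_ Bv old)
    more-edges (inj₂ e) = edgeCount-insert H B⊆B′ e (∧-intro B′w B′v) (cong₂ _∧_ old Bv)
    B′-tight : Tight B′
    B′-tight = subst (ℕ._≤ suc (edgeCount H (within B′))) (sym (size-insert B old))
                 (s≤s (ℕ.≤-trans B-tight (more-edges vw)))

  go : ∀ k B → B ⊆ S → B a ≡ true → size S ℕ.≤ k + size B → Tight B → Tight S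
  go k B B⊆S Ba slack B-tight with extend B B⊆S Ba B-tight
  ... | inj₁ S⊆B =
    ℕ.≤-trans (size-mono S⊆B) (ℕ.≤-trans B-tight (s≤s (edgeCount-within-mono H B⊆S)))
  ... | inj₂ (B′ , B′⊆S , B′a , size-B′ , B′-tight) with k
  ...   | zero  =
    ⊥-elim (ℕ.<-irrefl refl (ℕ.≤-trans (subst (ℕ._≤ size S) size-B′ (size-mono B′⊆S)) slack))
  ...   | suc k = go k B′ B′⊆S B′a slack′ B′-tight
    where
    slack′ : size S ℕ.≤ k + size B′
    slack′ = subst (size S ℕ.≤_) (trans (sym (ℕ.+-suc k (size B))) (cong (k +_) (sym size-B′))) slack

-- Cutting S along a component of H cuts no edge of G, so x(E[S]) splits as |H[S]| does;
-- on a connected piece the forest constraint and |S| ≤ 1 + |H[S]| finish.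
ForestInequalities : Graph n → (Fin n → Fin n → ℚ) → Set
ForestInequalities {n} G x =
  (S : Subset n) → 2 ℕ.≤ size S → ℚE.edgeSum (adj G) (within S) x ≤ ℕtoℚ (size S) - 1ℚ

SpansClosed : Graph n → EdgeRel n → Set
SpansClosed {n} G H = (A : Subset n) → Closed H A → Closed (adj G) A

edgeSum≤edgeCount : (G : Graph n) (x : Fin n → Fin n → ℚ) → ForestInequalities G x →
  (H : EdgeRel n) → SpansClosed G H →
  ∀ S → Closed H S → ℚE.edgeSum (adj G) (within S) x ≤ ℕtoℚ (edgeCount H (within S))
edgeSum≤edgeCount {n} G x forest-inequality H spans S S-closed = go (size S) S ℕ.≤-refl S-closed
  where
  weight count : Subset n → ℚ
  weight S = ℚE.edgeSum (adj G) (within S) x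
  count  S = ℕtoℚ (edgeCount H (within S))

  edgeless : ∀ S → (∀ i j → isEdgeᵇ (adj G) i j ∧ within S i j ≡ false) → weight S ≤ count S
  edgeless S none =
    subst (_≤ count S) (sym (ℚE.edgeSum-none x none)) (ℕtoℚ-mono {0} {edgeCount H (within S)} z≤n)

  go : ∀ m S → size S ℕ.≤ m → Closed H S → weight S ≤ count S
  go m S size≤ S-closed with empty-or-witness S
  ... | inj₁ empty = edgeless S none
    where
    none : ∀ i j → isEdgeᵇ (adj G) i j ∧ within S i j ≡ false
    none i j rewrite empty i = ∧-zeroʳ _
  ... | inj₂ (a , Sa) with ⊆-or-witness S (component H a)
  ...   | inj₁ connected with 2 ℕ.≤? size S
  ...     | yes two = ℚ.≤-trans (forest-inequality S two)
                        (ℕtoℚ-≤-suc (connected⇒size≤edges H S-closed Sa connected))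
  ...     | no ¬two = edgeless S none
    where
    none : ∀ i j → isEdgeᵇ (adj G) i j ∧ within S i j ≡ false
    none i j with isEdgeᵇ (adj G) i j ∧ within S i j in e
    ... | false = refl
    ... | true  = ⊥-elim (¬two (size≥2 S (∧-elimˡ {S i} Sij) (∧-elimʳ {S i} Sij) (<ᵇ-irrefl i j i<j)))
      where
      Sij = ∧-elimʳ {isEdgeᵇ (adj G) i j} e
      i<j = ∧-elimˡ {i <ᵇ j} (∧-elimˡ {isEdgeᵇ (adj G) i j} e)
  go (suc m) S size≤ S-closed | inj₂ (a , Sa) | inj₂ (b , Sb , b∉A) = begin
    weight S                                ≡⟨ ℚE.edgeSum-split S x (λ i j e _ → spans A A-closed i j e) ⟩
    weight (S ∩ A) ℚ.+ weight (S ∖ A)       ≤⟨ ℚ.+-mono-≤ (go m (S ∩ A) (part (size-∩-< S A b∈)) (Closed-∩ S-closed A-closed))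
                                                          (go m (S ∖ A) (part (size-∖-< S A a∈)) (Closed-∖ S-closed A-closed)) ⟩
    count (S ∩ A) ℚ.+ count (S ∖ A)         ≡⟨ ℕtoℚ-+ (edgeCount H (within (S ∩ A))) _ ⟨
    ℕtoℚ (edgeCount H (within (S ∩ A)) + edgeCount H (within (S ∖ A)))
                                            ≡⟨ cong ℕtoℚ (edgeCount-split S A (λ i j e _ → A-closed i j e)) ⟨
    count S                                 ∎
    where
    open ℚ.≤-Reasoning
    A = component H a
    A-closed = component-Closed H a
    a∈ : (S ∩ A) a ≡ true
    a∈ = ∧-intro Sa (component-self H a)
    b∈ : (S ∖ A) b ≡ true
    b∈ = ∧-intro Sb (cong not b∉A)
    part : ∀ {k} → k ℕ.< size S → k ℕ.≤ m
    part k< = ℕ.≤-pred (ℕ.≤-trans k< size≤)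
  go zero S size≤ S-closed | inj₂ (a , Sa) | inj₂ _ =
    ⊥-elim (ℕ.<-irrefl refl (ℕ.<-≤-trans (size-pos S Sa) size≤))

sumEdges≤numEdges : (G : Graph n) {x : Fin n → Fin n → ℚ} → ForestInequalities G x →
  (H : EdgeRel n) → SpansClosed G H → sumEdges (adj G) allPairs x ≤ ℕtoℚ (numEdges H)
sumEdges≤numEdges G {x} inequalities H spans =
  subst₂ _≤_ (sym (sumEdges≡edgeSum (adj G) allPairs x)) (cong ℕtoℚ (sym (numEdges≡edgeCount H)))
    (edgeSum≤edgeCount G x inequalities H spans full (λ _ _ _ → refl))

Spans⇒SpansClosed : (G : Graph n) {F : EdgeRel n} → Spans (adj G) F → SpansClosed G F
Spans⇒SpansClosed G spans A closed i j e = Closed-Walk closed (spans i j e)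

InPolytope⇒ForestInequalities : (G : Graph n) {Δ : ℚ} {x : Fin n → Fin n → ℚ} →
  InPolytope G Δ x → ForestInequalities G x
InPolytope⇒ForestInequalities G {x = x} (_ , subset-constraint , _) S two =
  subst₂ (λ w k → w ≤ ℕtoℚ k - 1ℚ) (sumEdges≡edgeSum (adj G) (within S) x) (card≡size S)
    (subset-constraint S (subst (2 ℕ.≤_) (sym (card≡size S)) two))

independent⇒ForestInequalities : (G : Graph n) {F : EdgeRel n} →
  (∀ i j → IsEdge F i j → IsEdge (adj G) i j) → Independent F → ForestInequalities G (indicator F)
independent⇒ForestInequalities G {F} F⊆G independent S two =
  subst (_≤ ℕtoℚ (size S) - 1ℚ)
    (trans (sym (sumEdges-indicator (within S) F⊆G)) (sumEdges≡edgeSum (adj G) (within S) (indicator F)))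
    (ℕtoℚ-< (independent S (ℕ.<-trans (s≤s z≤n) two)))

indicator-in-polytope : (G : Graph n) {Δ : ℚ} {d : ℕ} {F : EdgeRel n} →
  (∀ i j → IsEdge F i j → IsEdge (adj G) i j) → Independent F → (∀ v → degree F v ℕ.≤ suc d) →
  ℕtoℚ d ℚ.+ 1ℚ ≤ Δ → InPolytope G Δ (indicator F)
indicator-in-polytope G {Δ} {d} {F} F⊆G independent degree≤ Δ-large =
  nonneg , subset-constraint , degree-constraint
  where
  nonneg : ∀ i j → IsEdge (adj G) i j → 0ℚ ≤ indicator F i j
  nonneg i j _ with F i j
  ... | true  = ℕtoℚ-mono {0} {1} z≤n
  ... | false = ℚ.≤-refl
  subset-constraint : ∀ S → 2 ℕ.≤ card S →
    sumEdges (adj G) (within S) (indicator F) ≤ ℕtoℚ (card S) - 1ℚ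
  subset-constraint S two =
    subst₂ (λ w k → w ≤ ℕtoℚ k - 1ℚ)
      (sym (sumEdges≡edgeSum (adj G) (within S) (indicator F))) (sym (card≡size S))
      (independent⇒ForestInequalities G F⊆G independent S (subst (2 ℕ.≤_) (card≡size S) two))
  degree-constraint : ∀ v → sumEdges (adj G) (incident v) (indicator F) ≤ Δ
  degree-constraint v = subst (_≤ Δ) (sym (sumEdges-indicator (incident v) F⊆G))
    (ℚ.≤-trans (ℕtoℚ-mono (degree≤ v)) (subst (_≤ Δ) (sym (ℕtoℚ-suc d)) Δ-large))

module _ (G : Graph n) where

  induced-elim : ∀ S i j → IsEdge (induced G S) i j → S i ≡ true × S j ≡ true × adj G i j ≡ true
  induced-elim S i j e =
    ∧-elimˡ {S i} Sij , ∧-elimˡ {S j} (∧-elimʳ {S i} Sij) , ∧-elimʳ {S j} (∧-elimʳ {S i} Sij)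
    where
    Sij = ∧-elimʳ {i <ᵇ j} e

  induced-intro : ∀ S i j → (i <ᵇ j) ≡ true → S i ≡ true → S j ≡ true → adj G i j ≡ true →
    IsEdge (induced G S) i j
  induced-intro S i j i<j Si Sj a = ∧-intro i<j (∧-intro Si (∧-intro Sj a))

  induced-Adj : ∀ S u w → S u ≡ true → S w ≡ true → adj G u w ≡ true → u ≢ w → Adj (induced G S) u w
  induced-Adj S u w Su Sw a u≢w with <ᵇ-total u w u≢w
  ... | inj₁ u<w = inj₁ (induced-intro S u w u<w Su Sw a)
  ... | inj₂ w<u = inj₂ (induced-intro S w u w<u Sw Su (trans (adj-sym G w u) a))

  induced-mono : ∀ {S₁ S₂} → S₁ ⊆ S₂ → ∀ i j → IsEdge (induced G S₁) i j → IsEdge (induced G S₂) i j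
  induced-mono {S₁} S₁⊆S₂ i j e with induced-elim S₁ i j e
  ... | Si , Sj , a = induced-intro _ i j (∧-elimˡ {i <ᵇ j} e) (S₁⊆S₂ i Si) (S₁⊆S₂ j Sj) a

  induced-Closed : ∀ S → Closed (induced G S) S
  induced-Closed S i j e with induced-elim S i j e
  ... | Si , Sj , _ = trans Si (sym Sj)

Separated : Graph n → Subset n → Subset n → Set
Separated G S R = ∀ u w → R u ≡ true → R w ≡ true → u ≢ w → component (induced G S) u w ≡ false

-- Each vertex of R is joined to an earlier root outside G[S], so its degree in F must leave
-- room for that edge.
record BoundedSpanningForest (G : Graph n) (D : ℕ) (S R : Subset n) (F : EdgeRel n) : Set where
  field
    ⊆-induced   : ∀ i j → IsEdge F i j → IsEdge (induced G S) i j
    independent : Independent F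
    degree≤     : ∀ v → degree F v ℕ.≤ suc D
    degree≤-R   : ∀ v → R v ≡ true → degree F v ℕ.≤ D
    spans       : ∀ A → Closed F A → Closed (induced G S) A

module Extend {n : ℕ} (G : Graph n) (D : ℕ) (DS≤ : ∀ d → NodeNeighbourDiff G d → d ℕ.≤ D)
  (S R : Subset n) (R⊆S : R ⊆ S) (R-separated : Separated G S R)
  (r : Fin n) (Sr : S r ≡ true)
  (r-separated : ∀ u → R u ≡ true → u ≡ r ⊎ component (induced G S) u r ≡ false)
  where

  S′ : Subset n
  S′ = delete S r

  N : Subset n
  N u = S′ u ∧ adj G r u

  C : Fin n → Subset n
  C = component (induced G S′)

  earlier : Fin n → Bool
  earlier u = ⌊ any? (λ w → (w <ᵇ u) ∧ (N w ∧ C u w) ≟ᵇ true) ⌋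

  -- I picks the least neighbour of r in each component of G[S′] that r is adjacent to.
  I : Subset n
  I u = N u ∧ not (earlier u)

  star : EdgeRel n
  star i j = (⌊ i ≟ r ⌋ ∧ I j) ∨ (⌊ j ≟ r ⌋ ∧ I i)

  R′ : Subset n
  R′ u = (R u ∧ not ⌊ u ≟ r ⌋) ∨ I u

  S′-elim : ∀ {u} → S′ u ≡ true → S u ≡ true × u ≢ r
  S′-elim {u} h = ∧-elimˡ {S u} h , ≟-false⇒≢ (not-true (∧-elimʳ {S u} h))

  S′-intro : ∀ {u} → S u ≡ true → u ≢ r → S′ u ≡ true
  S′-intro Su u≢r = ∧-intro Su (cong not (≢⇒≟-false u≢r))

  S′⊆S : S′ ⊆ S
  S′⊆S u h = proj₁ (S′-elim h)

  N-elim : ∀ {u} → N u ≡ true → S′ u ≡ true × adj G r u ≡ true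
  N-elim {u} h = ∧-elimˡ {S′ u} h , ∧-elimʳ {S′ u} h

  I⊆N : I ⊆ N
  I⊆N u h = ∧-elimˡ {N u} h

  I⊆S′ : I ⊆ S′
  I⊆S′ u h = proj₁ (N-elim (I⊆N u h))

  I≢r : ∀ {u} → I u ≡ true → u ≢ r
  I≢r {u} h = proj₂ (S′-elim (I⊆S′ u h))

  C-avoids-r : ∀ u → S′ u ≡ true → C u r ≡ false
  C-avoids-r u S′u with C u r in Cur
  ... | false = refl
  ... | true  = ⊥-elim (proj₂ (S′-elim (component-least _ u (induced-Closed G S′) S′u r Cur)) refl)

  earlier-intro : ∀ {u w} → (w <ᵇ u) ≡ true → N w ≡ true → C u w ≡ true → earlier u ≡ true
  earlier-intro {u} {w} w<u Nw Cuw with any? (λ w → (w <ᵇ u) ∧ (N w ∧ C u w) ≟ᵇ true)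
  ... | yes _  = refl
  ... | no ∄w = ⊥-elim (∄w (w , ∧-intro w<u (∧-intro Nw Cuw)))

  earlier-elim : ∀ u → earlier u ≡ true → ∃ λ w → (w <ᵇ u) ≡ true × N w ≡ true × C u w ≡ true
  earlier-elim u h with any? (λ w → (w <ᵇ u) ∧ (N w ∧ C u w) ≟ᵇ true)
  ... | yes (w , found) = w , ∧-elimˡ {w <ᵇ u} found , ∧-elimˡ {N w} (∧-elimʳ {w <ᵇ u} found)
                            , ∧-elimʳ {N w} (∧-elimʳ {w <ᵇ u} found)

  I-least : ∀ {u w} → I u ≡ true → (w <ᵇ u) ≡ true → N w ≡ true → C u w ≡ false
  I-least {u} {w} Iu w<u Nw with C u w in Cuw
  ... | false = refl
  ... | true  = ⊥-elim (true≢false (earlier-intro w<u Nw Cuw) (not-true (∧-elimʳ {N u} Iu)))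

  I-separated : ∀ u w → I u ≡ true → I w ≡ true → u ≢ w → C u w ≡ false
  I-separated u w Iu Iw u≢w with <ᵇ-total w u (u≢w ∘ sym)
  ... | inj₁ w<u = I-least Iu w<u (I⊆N w Iw)
  ... | inj₂ u<w with C u w in Cuw
  ...   | false = refl
  ...   | true  = ⊥-elim (true≢false (component-sym _ u w Cuw) (I-least Iw u<w (I⊆N u Iu)))

  I-no-edge : ∀ u w → I u ≡ true → I w ≡ true → u ≢ w → adj G u w ≢ true
  I-no-edge u w Iu Iw u≢w a =
    true≢false (Walk⇒component (induced G S′) {u} {w}
                 (step (induced-Adj G S′ u w (I⊆S′ u Iu) (I⊆S′ w Iw) a u≢w) here))
               (I-separated u w Iu Iw u≢w)

  representative : ∀ w → N w ≡ true → ∃ λ u → I u ≡ true × C u w ≡ true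
  representative w Nw = go (suc (toℕ w)) w ℕ.≤-refl Nw
    where
    go : ∀ k w → toℕ w ℕ.< k → N w ≡ true → ∃ λ u → I u ≡ true × C u w ≡ true
    go (suc k) w w<k Nw with earlier w in earlier-w
    ... | false = w , ∧-intro Nw (cong not earlier-w) , component-self _ w
    ... | true with earlier-elim w earlier-w
    ...   | w′ , w′<w , Nw′ , Cww′ with go k w′ (ℕ.≤-trans (<ᵇ⇒< w′ w w′<w) (ℕ.≤-pred w<k)) Nw′
    ...     | u , Iu , Cuw′ = u , Iu , component-trans _ u w′ w Cuw′ (component-sym _ w w′ Cww′)

  star-elim : ∀ i j → star i j ≡ true → (i ≡ r × I j ≡ true) ⊎ (j ≡ r × I i ≡ true)
  star-elim i j h with ∨-elim {⌊ i ≟ r ⌋ ∧ I j} h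
  ... | inj₁ e = inj₁ (≟⇒≡ (∧-elimˡ {⌊ i ≟ r ⌋} e) , ∧-elimʳ {⌊ i ≟ r ⌋} e)
  ... | inj₂ e = inj₂ (≟⇒≡ (∧-elimˡ {⌊ j ≟ r ⌋} e) , ∧-elimʳ {⌊ j ≟ r ⌋} e)

  star-Adj : ∀ u → I u ≡ true → Adj star r u
  star-Adj u Iu with <ᵇ-total r u (I≢r Iu ∘ sym)
  ... | inj₁ r<u = inj₁ (∧-intro r<u (∨-introˡ (∧-intro (≟-refl r) Iu)))
  ... | inj₂ u<r = inj₂ (∧-intro u<r (∨-introʳ {⌊ u ≟ r ⌋ ∧ I r} (∧-intro (≟-refl r) Iu)))

  S₀ : Subset n
  S₀ = ⁅ r ⁆ ∪ I

  S₀-elim : ∀ u → S₀ u ≡ true → u ≡ r ⊎ I u ≡ true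
  S₀-elim u h with ∨-elim {⌊ u ≟ r ⌋} h
  ... | inj₁ u≟r = inj₁ (≟⇒≡ u≟r)
  ... | inj₂ Iu  = inj₂ Iu

  star⊆G[S₀] : ∀ i j → IsEdge star i j → IsEdge (induced G S₀) i j
  star⊆G[S₀] i j e with star-elim i j (∧-elimʳ {i <ᵇ j} e)
  ... | inj₁ (refl , Ij) = induced-intro G S₀ r j (∧-elimˡ {r <ᵇ j} e) (∨-introˡ (≟-refl r))
                             (∨-introʳ {⌊ j ≟ r ⌋} Ij) (proj₂ (N-elim (I⊆N j Ij)))
  ... | inj₂ (refl , Ii) = induced-intro G S₀ i r (∧-elimˡ {i <ᵇ r} e) (∨-introʳ {⌊ i ≟ r ⌋} Ii)
                             (∨-introˡ (≟-refl r)) (trans (adj-sym G i r) (proj₂ (N-elim (I⊆N i Ii))))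

  star-pair : ∀ c → c ≢ r → ∀ p q → star p q ≡ true → p ≡ c ⊎ q ≡ c →
    (p ≡ r × q ≡ c) ⊎ (p ≡ c × q ≡ r)
  star-pair c c≢r p q h ∋c with star-elim p q h | ∋c
  ... | inj₁ (refl , _) | inj₁ refl = ⊥-elim (c≢r refl)
  ... | inj₁ (refl , _) | inj₂ refl = inj₁ (refl , refl)
  ... | inj₂ (refl , _) | inj₁ refl = inj₂ (refl , refl)
  ... | inj₂ (refl , _) | inj₂ refl = ⊥-elim (c≢r refl)

  -- Removing a star edge leaves its leaf isolated.
  star-acyclic : ∀ i j → IsEdge star i j → ¬ Walk (removeEdge star i j) i j
  star-acyclic i j e walk with star-elim i j (∧-elimʳ {i <ᵇ j} e)
  ... | inj₁ (refl , Ij) = I≢r Ij (isolated⇒stuck (removeEdge-isolates e only-rj) (Walk-reverse walk))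
    where
    only-rj : ∀ p q → IsEdge star p q → p ≡ j ⊎ q ≡ j → (p ≡ r × q ≡ j) ⊎ (p ≡ j × q ≡ r)
    only-rj p q e′ = star-pair j (I≢r Ij) p q (∧-elimʳ {p <ᵇ q} e′)
  ... | inj₂ (refl , Ii) = I≢r Ii (isolated⇒stuck (removeEdge-isolates e only-ir) walk)
    where
    only-ir : ∀ p q → IsEdge star p q → p ≡ i ⊎ q ≡ i → (p ≡ i × q ≡ r) ⊎ (p ≡ r × q ≡ i)
    only-ir p q e′ ∋i = Data.Sum.swap (star-pair i (I≢r Ii) p q (∧-elimʳ {p <ᵇ q} e′) ∋i)

  star-spans : Spans (induced G S₀) star
  star-spans i j e with induced-elim G S₀ i j e
  ... | S₀i , S₀j , a with S₀-elim i S₀i | S₀-elim j S₀j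
  ... | inj₁ refl | inj₁ refl = ⊥-elim (<ᵇ-irrefl r r (∧-elimˡ {r <ᵇ r} e) refl)
  ... | inj₁ refl | inj₂ Ij   = step (star-Adj j Ij) here
  ... | inj₂ Ii   | inj₁ refl = Walk-reverse (step (star-Adj i Ii) here)
  ... | inj₂ Ii   | inj₂ Ij   = ⊥-elim (I-no-edge i j Ii Ij (<ᵇ-irrefl i j (∧-elimˡ {i <ᵇ j} e)) a)

  S₀-r-edgeless : ∀ i j → ¬ IsEdge (induced G (delete S₀ r)) i j
  S₀-r-edgeless i j e with induced-elim G (delete S₀ r) i j e
  ... | S₀i , S₀j , a = I-no-edge i j (only-I i S₀i) (only-I j S₀j) (<ᵇ-irrefl i j (∧-elimˡ {i <ᵇ j} e)) a
    where
    only-I : ∀ k → delete S₀ r k ≡ true → I k ≡ true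
    only-I k h with S₀-elim k (∧-elimˡ {S₀ k} h)
    ... | inj₁ refl = ⊥-elim (true≢false (≟-refl r) (not-true (∧-elimʳ {S₀ r} h)))
    ... | inj₂ Ik   = Ik

  -- The star is a spanning forest of G[{r} ∪ I], while G[I] has no edges.
  star-size≤D : numEdges star ℕ.≤ D
  star-size≤D = DS≤ (numEdges star)
    ( S₀ , r , ∨-introˡ (≟-refl r) , numEdges star , 0
    , (star , (star⊆G[S₀] , star-acyclic) , star-spans , refl)
    , (∅ᴱ , ((λ i j e → ⊥-elim (∅ᴱ-no-edge i j e)) , (λ i j e → ⊥-elim (∅ᴱ-no-edge i j e)))
          , (λ i j e → ⊥-elim (S₀-r-edgeless i j e)) , numEdges-∅ᴱ {n})
    , sym (ℕ.∣-∣-identityʳ (numEdges star)) )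

  degree-star-r : degree star r ℕ.≤ D
  degree-star-r = ℕ.≤-trans (edgeCount-mono λ i j h → ∧-intro (∧-elimˡ {isEdgeᵇ star i j} h) refl)
                            (subst (ℕ._≤ D) (numEdges≡edgeCount star) star-size≤D)

  degree-star-I : ∀ v → v ≢ r → degree star v ℕ.≤ 1
  degree-star-I v v≢r = edgeCount≤1 r v λ i j h →
    star-pair v v≢r i j (∧-elimʳ {i <ᵇ j} (∧-elimˡ {isEdgeᵇ star i j} h))
                        (incident-elim {v = v} i j (∧-elimʳ {isEdgeᵇ star i j} h))

  degree-star-outside : ∀ v → v ≢ r → I v ≡ false → degree star v ≡ 0
  degree-star-outside v v≢r Iv = edgeCount-none none
    where
    none : ∀ i j → isEdgeᵇ star i j ∧ incident v i j ≡ false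
    none i j with isEdgeᵇ star i j ∧ incident v i j in h
    ... | false = refl
    ... | true with star-elim i j (∧-elimʳ {i <ᵇ j} (∧-elimˡ {isEdgeᵇ star i j} h))
                  | incident-elim {v = v} i j (∧-elimʳ {isEdgeᵇ star i j} h)
    ...   | inj₁ (i≡r , _)  | inj₁ i≡v = ⊥-elim (v≢r (trans (sym i≡v) i≡r))
    ...   | inj₁ (_ , Ij)    | inj₂ j≡v = ⊥-elim (true≢false (subst (λ x → I x ≡ true) j≡v Ij) Iv)
    ...   | inj₂ (_ , Ii)    | inj₁ i≡v = ⊥-elim (true≢false (subst (λ x → I x ≡ true) i≡v Ii) Iv)
    ...   | inj₂ (j≡r , _)   | inj₂ j≡v = ⊥-elim (v≢r (trans (sym j≡v) j≡r))

  R′-elim : ∀ u → R′ u ≡ true → (R u ≡ true × u ≢ r) ⊎ I u ≡ true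
  R′-elim u h with ∨-elim {R u ∧ not ⌊ u ≟ r ⌋} h
  ... | inj₁ e  = inj₁ (∧-elimˡ {R u} e , ≟-false⇒≢ (not-true (∧-elimʳ {R u} e)))
  ... | inj₂ Iu = inj₂ Iu

  R′⊆S′ : R′ ⊆ S′
  R′⊆S′ u h with R′-elim u h
  ... | inj₁ (Ru , u≢r) = S′-intro (R⊆S u Ru) u≢r
  ... | inj₂ Iu         = I⊆S′ u Iu

  C⊆component-S : ∀ u w → C u w ≡ true → component (induced G S) u w ≡ true
  C⊆component-S u w h =
    Walk⇒component (induced G S) (Walk-map (induced-mono G S′⊆S) (component⇒Walk (induced G S′) u w h))

  R-I-separated : ∀ u w → R u ≡ true → u ≢ r → I w ≡ true → C u w ≡ false
  R-I-separated u w Ru u≢r Iw with C u w in Cuw | r-separated u Ru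
  ... | false | _         = refl
  ... | true  | inj₁ u≡r  = ⊥-elim (u≢r u≡r)
  ... | true  | inj₂ u≁r  = ⊥-elim (true≢false (Walk⇒component (induced G S) u~r) u≁r)
    where
    w-r : Adj (induced G S) w r
    w-r = induced-Adj G S w r (S′⊆S w (I⊆S′ w Iw)) Sr
            (trans (adj-sym G w r) (proj₂ (N-elim (I⊆N w Iw)))) (I≢r Iw)
    u~r : Walk (induced G S) u r
    u~r = component⇒Walk (induced G S) u w (C⊆component-S u w Cuw) ++ʷ step w-r here

  R′-separated : Separated G S′ R′
  R′-separated u w R′u R′w u≢w with C u w in Cuw
  ... | false = refl
  ... | true with R′-elim u R′u | R′-elim w R′w
  ...   | inj₁ (Ru , _)   | inj₁ (Rw , _)   =
            ⊥-elim (true≢false (C⊆component-S u w Cuw) (R-separated u w Ru Rw u≢w))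
  ...   | inj₁ (Ru , u≢r) | inj₂ Iw         = ⊥-elim (true≢false Cuw (R-I-separated u w Ru u≢r Iw))
  ...   | inj₂ Iu         | inj₁ (Rw , w≢r) =
            ⊥-elim (true≢false (component-sym _ u w Cuw) (R-I-separated w u Rw w≢r Iu))
  ...   | inj₂ Iu         | inj₂ Iw         = ⊥-elim (true≢false Cuw (I-separated u w Iu Iw u≢w))

  module _ (F′ : EdgeRel n) (F′-forest : BoundedSpanningForest G D S′ R′ F′) where
    private
      module F′ = BoundedSpanningForest F′-forest

    F : EdgeRel n
    F i j = F′ i j ∨ star i j

    F-elim : ∀ i j → IsEdge F i j → IsEdge F′ i j ⊎ IsEdge star i j
    F-elim i j e with ∨-elim {F′ i j} (∧-elimʳ {i <ᵇ j} e)
    ... | inj₁ f = inj₁ (∧-intro (∧-elimˡ {i <ᵇ j} e) f)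
    ... | inj₂ s = inj₂ (∧-intro (∧-elimˡ {i <ᵇ j} e) s)

    F′-avoids-r : ∀ i j → IsEdge F′ i j → i ≢ r × j ≢ r
    F′-avoids-r i j f with induced-elim G S′ i j (F′.⊆-induced i j f)
    ... | S′i , S′j , _ = proj₂ (S′-elim S′i) , proj₂ (S′-elim S′j)

    S₀⊆S : S₀ ⊆ S
    S₀⊆S u h with S₀-elim u h
    ... | inj₁ refl = Sr
    ... | inj₂ Iu   = S′⊆S u (I⊆S′ u Iu)

    ⊆-induced : ∀ i j → IsEdge F i j → IsEdge (induced G S) i j
    ⊆-induced i j e with F-elim i j e
    ... | inj₁ f = induced-mono G S′⊆S i j (F′.⊆-induced i j f)
    ... | inj₂ s = induced-mono G S₀⊆S i j (star⊆G[S₀] i j s)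

    degree-F′-r : degree F′ r ≡ 0
    degree-F′-r = edgeCount-none none
      where
      none : ∀ i j → isEdgeᵇ F′ i j ∧ incident r i j ≡ false
      none i j with isEdgeᵇ F′ i j ∧ incident r i j in h
      ... | false = refl
      ... | true with F′-avoids-r i j (∧-elimˡ {isEdgeᵇ F′ i j} h)
                    | incident-elim {v = r} i j (∧-elimʳ {isEdgeᵇ F′ i j} h)
      ...   | i≢r , _ | inj₁ i≡r = ⊥-elim (i≢r i≡r)
      ...   | _ , j≢r | inj₂ j≡r = ⊥-elim (j≢r j≡r)

    degree-F : ∀ v → degree F v ℕ.≤ degree F′ v + degree star v
    degree-F v = edgeCount-∪ F′ star (incident v)

    degree-F-r : degree F r ℕ.≤ D
    degree-F-r =
      ℕ.≤-trans (degree-F r) (subst (λ k → k + degree star r ℕ.≤ D) (sym degree-F′-r) degree-star-r)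

    degree-F-outside : ∀ v → v ≢ r → I v ≡ false → degree F v ℕ.≤ degree F′ v
    degree-F-outside v v≢r Iv = ℕ.≤-trans (degree-F v)
      (ℕ.≤-reflexive (trans (cong (degree F′ v +_) (degree-star-outside v v≢r Iv)) (ℕ.+-identityʳ _)))

    degree≤ : ∀ v → degree F v ℕ.≤ suc D
    degree≤ v with v ≟ r
    ... | yes refl = ℕ.≤-trans degree-F-r (ℕ.n≤1+n D)
    ... | no v≢r with I v in Iv
    ...   | false = ℕ.≤-trans (degree-F-outside v v≢r Iv) (F′.degree≤ v)
    ...   | true  = ℕ.≤-trans (degree-F v)
                      (subst (degree F′ v + degree star v ℕ.≤_) (ℕ.+-comm D 1)
                        (ℕ.+-mono-≤ (F′.degree≤-R v (∨-introʳ {R v ∧ not ⌊ v ≟ r ⌋} Iv)) (degree-star-I v v≢r)))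

    degree≤-R : ∀ v → R v ≡ true → degree F v ℕ.≤ D
    degree≤-R v Rv with v ≟ r
    ... | yes refl = degree-F-r
    ... | no v≢r with I v in Iv
    ...   | false = ℕ.≤-trans (degree-F-outside v v≢r Iv)
                      (F′.degree≤-R v (∨-introˡ (∧-intro Rv (cong not (≢⇒≟-false v≢r)))))
    ...   | true  = ⊥-elim (true≢false (component-self _ v) (R-I-separated v v Rv v≢r Iv))

    -- r joins, through I, every component of G[S′] it is adjacent to.
    module Spans (A : Subset n) (A-closed : Closed F A) where

      A-closed′ : Closed (induced G S′) A
      A-closed′ = F′.spans A λ i j f → A-closed i j (IsEdge-map {R = F′} {R′ = F} i j ∨-introˡ f)

      star-F : ∀ {u} → Adj star r u → Adj F r u
      star-F {u} (inj₁ s) = inj₁ (IsEdge-map {R = star} {R′ = F} r u (∨-introʳ {F′ r u}) s)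
      star-F {u} (inj₂ s) = inj₂ (IsEdge-map {R = star} {R′ = F} u r (∨-introʳ {F′ u r}) s)

      r~ : ∀ w → N w ≡ true → A r ≡ A w
      r~ w Nw with representative w Nw
      ... | u , Iu , Cuw = trans (Closed-Adj {R = F} A-closed {r} {u} (star-F (star-Adj u Iu)))
                                 (Closed-Walk A-closed′ (component⇒Walk (induced G S′) u w Cuw))

      closed : Closed (induced G S) A
      closed i j e with induced-elim G S i j e | i ≟ r | j ≟ r
      ... | _ , Sj , a | yes refl | _       =
            r~ j (∧-intro (S′-intro Sj (<ᵇ-irrefl r j (∧-elimˡ {r <ᵇ j} e) ∘ sym)) a)
      ... | Si , _ , a | no _     | yes refl =
            sym (r~ i (∧-intro (S′-intro Si (<ᵇ-irrefl i r (∧-elimˡ {i <ᵇ r} e))) (trans (adj-sym G r i) a)))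
      ... | Si , Sj , a | no i≢r  | no j≢r  =
            A-closed′ i j (induced-intro G S′ i j (∧-elimˡ {i <ᵇ j} e) (S′-intro Si i≢r) (S′-intro Sj j≢r) a)

    spans : ∀ A → Closed F A → Closed (induced G S) A
    spans = Spans.closed

    -- If T contains r and some u ∈ I, the component of u in G[S′] cuts T and only the edge ru
    -- crosses it; otherwise F[T] = F′[T].
    independent : Independent F
    independent = independent-by-cuts F small-or-cut
      where
      small-or-cut : ∀ T → 0 ℕ.< size T → edgeCount F (within T) ℕ.< size T ⊎ Cut F T
      small-or-cut T pos with empty-or-witness (λ u → T r ∧ (I u ∧ T u))
      ... | inj₁ none = inj₁ (ℕ.≤-<-trans (edgeCount-mono only-F′) (F′.independent T pos))
        where
        only-F′ : ∀ i j → isEdgeᵇ F i j ∧ within T i j ≡ true → isEdgeᵇ F′ i j ∧ within T i j ≡ true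
        only-F′ i j h = ∧-intro (F′-edge (F-elim i j (∧-elimˡ {isEdgeᵇ F i j} h))) Tij
          where
          Tij : within T i j ≡ true
          Tij = ∧-elimʳ {isEdgeᵇ F i j} h
          Ti = ∧-elimˡ {T i} Tij
          Tj = ∧-elimʳ {T i} Tij
          F′-edge : IsEdge F′ i j ⊎ IsEdge star i j → IsEdge F′ i j
          F′-edge (inj₁ f) = f
          F′-edge (inj₂ s) with star-elim i j (∧-elimʳ {i <ᵇ j} s)
          ... | inj₁ (i≡r , Ij) =
                ⊥-elim (true≢false (∧-intro (subst (λ k → T k ≡ true) i≡r Ti) (∧-intro Ij Tj)) (none j))
          ... | inj₂ (j≡r , Ii) =
                ⊥-elim (true≢false (∧-intro (subst (λ k → T k ≡ true) j≡r Tj) (∧-intro Ii Ti)) (none i))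
      ... | inj₂ (u , found) = inj₂ (record
        { side     = C u
        ; p        = r
        ; q        = u
        ; inside   = u , ∧-intro Tu (component-self _ u)
        ; outside  = r , ∧-intro Tr (cong not (C-avoids-r u (I⊆S′ u Iu)))
        ; crossing = crossing
        })
        where
        Tr = ∧-elimˡ {T r} found
        Iu = ∧-elimˡ {I u} (∧-elimʳ {T r} found)
        Tu = ∧-elimʳ {I u} (∧-elimʳ {T r} found)
        C-avoids : ∀ {k} → k ≡ r → C u k ≡ false
        C-avoids refl = C-avoids-r u (I⊆S′ u Iu)
        crossing : ∀ i j → IsEdge F i j → within T i j ≡ true →
                   C u i ≡ C u j ⊎ (i ≡ r × j ≡ u) ⊎ (i ≡ u × j ≡ r)
        crossing i j e _ with F-elim i j e
        ... | inj₁ f = inj₁ (component-Closed (induced G S′) u i j (F′.⊆-induced i j f))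
        ... | inj₂ s with star-elim i j (∧-elimʳ {i <ᵇ j} s)
        ...   | inj₁ (i≡r , Ij) with j ≟ u
        ...     | yes j≡u = inj₂ (inj₁ (i≡r , j≡u))
        ...     | no j≢u  = inj₁ (trans (C-avoids i≡r) (sym (I-separated u j Iu Ij (j≢u ∘ sym))))
        crossing i j e _ | inj₂ s | inj₂ (j≡r , Ii) with i ≟ u
        ...     | yes i≡u = inj₂ (inj₂ (i≡u , j≡r))
        ...     | no i≢u  = inj₁ (trans (I-separated u i Iu Ii (i≢u ∘ sym)) (sym (C-avoids j≡r)))

    forest : BoundedSpanningForest G D S R F
    forest = record
      { ⊆-induced   = ⊆-induced
      ; independent = independent
      ; degree≤     = degree≤
      ; degree≤-R   = degree≤-R
      ; spans       = spans
      }

∅ᴱ-forest : (G : Graph n) (D : ℕ) (S R : Subset n) → (∀ i → S i ≡ false) →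
  BoundedSpanningForest G D S R ∅ᴱ
∅ᴱ-forest {n} G D S R S-empty = record
  { ⊆-induced   = λ i j e → ⊥-elim (∅ᴱ-no-edge i j e)
  ; independent = λ T pos → subst (ℕ._< size T) (sym (edgeless (within T))) pos
  ; degree≤     = λ v → subst (ℕ._≤ suc D) (sym (edgeless (incident v))) z≤n
  ; degree≤-R   = λ v _ → subst (ℕ._≤ D) (sym (edgeless (incident v))) z≤n
  ; spans       = λ A _ i j e → ⊥-elim (true≢false (proj₁ (induced-elim G S i j e)) (S-empty i))
  }
  where
  edgeless : (P : Fin n → Fin n → Bool) → edgeCount ∅ᴱ P ≡ 0
  edgeless P = edgeCount-none λ i j → cong (_∧ P i j) (∧-zeroʳ (i <ᵇ j))

module _ (G : Graph n) (D : ℕ) (DS≤ : ∀ d → NodeNeighbourDiff G d → d ℕ.≤ D) where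

  root : ∀ S R → R ⊆ S → Separated G S R → (∀ i → S i ≡ false) ⊎
         ∃ λ r → S r ≡ true × (∀ u → R u ≡ true → u ≡ r ⊎ component (induced G S) u r ≡ false)
  root S R R⊆S separated with empty-or-witness R
  ... | inj₂ (r , Rr) = inj₂ (r , R⊆S r Rr , r-separated)
    where
    r-separated : ∀ u → R u ≡ true → u ≡ r ⊎ component (induced G S) u r ≡ false
    r-separated u Ru with u ≟ r
    ... | yes u≡r = inj₁ u≡r
    ... | no u≢r  = inj₂ (separated u r Ru Rr u≢r)
  ... | inj₁ R-empty with empty-or-witness S
  ...   | inj₁ S-empty      = inj₁ S-empty
  ...   | inj₂ (r , Sr) = inj₂ (r , Sr , λ u Ru → ⊥-elim (true≢false Ru (R-empty u)))

  extend : ∀ S R → R ⊆ S → Separated G S R → ∀ r → S r ≡ true →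
    (∀ u → R u ≡ true → u ≡ r ⊎ component (induced G S) u r ≡ false) →
    (∀ S′ R′ → size S′ ℕ.< size S → R′ ⊆ S′ → Separated G S′ R′ → ∃ (BoundedSpanningForest G D S′ R′)) →
    ∃ (BoundedSpanningForest G D S R)
  extend S R R⊆S separated r Sr r-separated recurse = E.F F′ F′-forest , E.forest F′ F′-forest
    where
    module E = Extend G D DS≤ S R R⊆S separated r Sr r-separated
    smaller : size E.S′ ℕ.< size S
    smaller = size-∖-< S ⁅ r ⁆ (∧-intro Sr (≟-refl r))
    F′ = proj₁ (recurse E.S′ E.R′ smaller E.R′⊆S′ E.R′-separated)
    F′-forest = proj₂ (recurse E.S′ E.R′ smaller E.R′⊆S′ E.R′-separated)

  bounded-spanning-forest : ∀ S R → R ⊆ S → Separated G S R → ∃ (BoundedSpanningForest G D S R)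
  bounded-spanning-forest S R = go (size S) S R ℕ.≤-refl
    where
    go : ∀ m S R → size S ℕ.≤ m → R ⊆ S → Separated G S R → ∃ (BoundedSpanningForest G D S R)
    go m S R size≤ R⊆S separated with root S R R⊆S separated
    ... | inj₁ S-empty = ∅ᴱ , ∅ᴱ-forest G D S R S-empty
    go zero    S R size≤ R⊆S separated | inj₂ (r , Sr , _) =
      ⊥-elim (ℕ.<-irrefl refl (ℕ.<-≤-trans (size-pos S Sr) size≤))
    go (suc m) S R size≤ R⊆S separated | inj₂ (r , Sr , r-separated) =
      extend S R R⊆S separated r Sr r-separated λ S′ R′ S′<S →
        go m S′ R′ (ℕ.≤-pred (ℕ.<-≤-trans S′<S size≤))

fΔ≡fsf : (n : ℕ) (G : Graph n) (Δ : ℚ) (d : ℕ) → IsDS G d → ℕtoℚ d ℚ.+ 1ℚ ≤ Δ →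
  (k : ℕ) → SFSize (adj G) k → IsFDelta G Δ (ℕtoℚ k)
fΔ≡fsf n G Δ d (DS≤d , _) Δ-large k (F₀ , (F₀⊆G , F₀-acyclic) , F₀-spans , |F₀|≡k) =
  upper , indicator F , in-polytope , ℚ.≤-antisym (upper (indicator F) in-polytope) lower
  where
  bounded = bounded-spanning-forest G d DS≤d full (λ _ → false) (λ _ ()) (λ _ _ ())
  F = proj₁ bounded
  module F = BoundedSpanningForest (proj₂ bounded)

  upper : ∀ x → InPolytope G Δ x → sumEdges (adj G) allPairs x ≤ ℕtoℚ k
  upper x x∈P = subst (λ m → sumEdges (adj G) allPairs x ≤ ℕtoℚ m) |F₀|≡k
    (sumEdges≤numEdges G (InPolytope⇒ForestInequalities G x∈P) F₀ (Spans⇒SpansClosed G F₀-spans))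

  in-polytope : InPolytope G Δ (indicator F)
  in-polytope = indicator-in-polytope G F.⊆-induced F.independent F.degree≤ Δ-large

  lower : ℕtoℚ k ≤ sumEdges (adj G) allPairs (indicator F)
  lower = begin
    ℕtoℚ k                                    ≡⟨ cong ℕtoℚ (trans (sym |F₀|≡k) (numEdges≡edgeCount F₀)) ⟩
    ℕtoℚ (edgeCount F₀ allPairs)              ≡⟨ sumEdges-indicator allPairs F₀⊆G ⟨
    sumEdges (adj G) allPairs (indicator F₀)  ≤⟨ sumEdges≤numEdges G F₀-inequalities F F.spans ⟩
    ℕtoℚ (numEdges F)                         ≡⟨ cong ℕtoℚ (numEdges≡edgeCount F) ⟩
    ℕtoℚ (edgeCount F allPairs)               ≡⟨ sumEdges-indicator allPairs F.⊆-induced ⟨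
    sumEdges (adj G) allPairs (indicator F)   ∎
    where
    open ℚ.≤-Reasoning
    F₀-inequalities = independent⇒ForestInequalities G F₀⊆G (acyclic⇒independent F₀-acyclic)

lemma1p9 :
  ((n : ℕ) (G : Graph n) (Δ : ℚ) (d : ℕ) → IsDS G d → ℕtoℚ d Data.Rational.+ 1ℚ ≤ Δ →
    (k : ℕ) → SFSize (adj G) k → IsFDelta G Δ (ℕtoℚ k))
  ×
  ((Δ : ℚ) → 1ℚ ≤ Δ → (n : ℕ) (G : Graph n) (d : ℕ) → IsDS G d → ℕtoℚ d ≤ Δ - 1ℚ →
    (k : ℕ) → SFSize (adj G) k → IsFDelta G Δ (ℕtoℚ k))
lemma1p9 = fΔ≡fsf , λ Δ _ n G d isDS d≤Δ-1 → fΔ≡fsf n G Δ d isDS (≤-1⇒+1≤ d≤Δ-1)
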